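{- Let $\alpha$ be an FLIF expression and let $\rho$ be a bijection from $O(\alpha)$ onto a set of variables disjoint from $\mathrm{vars}(\alpha)$. Then there exists an io-disjoint FLIF expression $\beta$ such that (1) $I(\beta)=I(\alpha)$; (2) $O(\beta)\supseteq\rho(O(\alpha))$; and (3) for every instance $D$ and every $\mathbb V$-valuation $\nu_1$, \[\{\nu_2|_{O(\alpha)}\mid(\nu_1,\nu_2)\in[\![\alpha]\!]^{\mathbb V}_D\}=\{\nu_2\circ\rho\mid(\nu_1,\nu_2)\in[\![\beta]\!]^{\mathbb V}_D\},\] where $\mathbb V$ is any set of variables containing $\mathrm{vars}(\alpha)$ and $\mathrm{vars}(\beta)$.
   Context: Fix a countably infinite set $\mathbf{dom}$ of constants. A schema $\mathcal S$ is a finite set of relation names $R$ with arity $\mathrm{ar}(R)$ and input arity $\mathrm{iar}(R)\le\mathrm{ar}(R)$; $\mathrm{oar}(R)=\mathrm{ar}(R)-\mathrm{iar}(R)$. An instance $D$ assigns each $R$ a relation $D(R)\subseteq\mathbf{dom}^{\mathrm{ar}(R)}$. An $X$-valuation is a map $X\to\mathbf{dom}$; $\nu(c)=c$ for constants; $\nu[x:=c]$ is $\nu$ changed at $x$. FLIF expressions over $\mathcal S$ and $\mathbb V$: atomic $R(\bar x;\bar y)$ ($\bar x$ of length $\mathrm{iar}(R)$, $\bar y$ of length $\mathrm{oar}(R)$, variables in $\mathbb V$), $(x=y)$, $(x=c)$, $(x:=y)$, $(x:=c)$; closed under $;$, $\cup$, $-$. $\mathrm{vars}(\alpha)$ is the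 set of variables occurring in $\alpha$. Semantics $[\![\alpha]\!]^{\mathbb V}_D$ (pairs of $\mathbb V$-valuations): $R(\bar x;\bar y)$: $(\nu_1,\nu_2)$ with $\nu_1(\bar x)\cdot\nu_2(\bar y)\in D(R)$ and $\nu_1,\nu_2$ agreeing outside the variables of $\bar y$; $(x=y)$: $(\nu,\nu)$ with $\nu(x)=\nu(y)$; $(x=c)$: $(\nu,\nu)$ with $\nu(x)=c$; $(x:=y)$: $(\nu,\nu[x:=\nu(y)])$; $(x:=c)$: $(\nu,\nu[x:=c])$; $;$ is relational composition, $\cup,-$ are union and difference. Input/output variables: $I(R(\bar x;\bar y))=X$, $O=Y$ (variables of $\bar x$, $\bar y$); $I(x=y)=\{x,y\}$, $O=\emptyset$; $I(x:=y)=\{y\}$, $O=\{x\}$; $I(x=c)=\{x\}$, $O=\emptyset$; $I(x:=c)=\emptyset$, $O=\{x\}$; $I(\alpha_1;\alpha_2)=I(\alpha_1)\cup(I(\alpha_2)\setminus O(\alpha_1))$, $O=O(\alpha_1)\cup O(\alpha_2)$; $I(\alpha_1\cup\alpha_2)=I(\alpha_1)\cup I(\alpha_2)\cup(O(\alpha_1)\triangle O(\alpha_2))$, $O=O(\alpha_1)\cup O(\alpha_2)$; $I(\alpha_1-\alpha_2)=I(\alpha_1)\cup I(\alpha_2)\cup(O(\alpha_1)\triangle O(\alpha_2))$, $O=O(\alpha_1)$. An expression is io-disjoint if $I(\beta)\cap O(\beta)=\emptyset$ for every subexpression $\beta$ (including itself). $\nu_2\circ\rho$ denotes the map $O(\alpha)\to\mathbf{dom}$,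 $x\mapsto\nu_2(\rho(x))$. -}

module Defs where

open import Data.Nat using (ℕ; _+_)
open import Data.Fin using (Fin)
open import Data.Vec using (Vec; _++_; map)
open import Data.Vec.Membership.Propositional using (_∈_)
open import Data.Product using (Σ; ∃; _×_; _,_)
open import Data.Sum using (_⊎_)
open import Data.Empty using (⊥)
open import Relation.Nullary using (¬_)
open import Relation.Binary.PropositionalEquality using (_≡_; _≢_)

Dom : Set
Dom = ℕ

Var : Set
Var = ℕ

record Schema : Set where
  field
    size : ℕ
    iar  : Fin size → ℕ
    oar  : Fin size → ℕ

  Rel : Set
  Rel = Fin size

  ar : Rel → ℕ
  ar R = iar R + oar R

open Schema public

Instance : Schema → Set₁
Instance S = (R : Rel S) → Vec Dom (ar S R) → Set

data Expr (S : Schema) : Set where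
  atom    : (R : Rel S) → Vec Var (iar S R) → Vec Var (oar S R) → Expr S
  eqv     : Var → Var → Expr S
  eqc     : Var → Dom → Expr S
  asgv    : Var → Var → Expr S
  asgc    : Var → Dom → Expr S
  _⨾_     : Expr S → Expr S → Expr S
  _∪ₑ_    : Expr S → Expr S → Expr S
  _−ₑ_    : Expr S → Expr S → Expr S

module _ {S : Schema} where

  vars : Expr S → Var → Set
  vars (atom R xs ys) z = z ∈ xs ⊎ z ∈ ys
  vars (eqv x y) z = z ≡ x ⊎ z ≡ y
  vars (eqc x c) z = z ≡ x
  vars (asgv x y) z = z ≡ x ⊎ z ≡ y
  vars (asgc x c) z = z ≡ x
  vars (a ⨾ b) z = vars a z ⊎ vars b z
  vars (a ∪ₑ b) z = vars a z ⊎ vars b z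
  vars (a −ₑ b) z = vars a z ⊎ vars b z

  Out : Expr S → Var → Set
  Out (atom R xs ys) z = z ∈ ys
  Out (eqv x y) z = ⊥
  Out (eqc x c) z = ⊥
  Out (asgv x y) z = z ≡ x
  Out (asgc x c) z = z ≡ x
  Out (a ⨾ b) z = Out a z ⊎ Out b z
  Out (a ∪ₑ b) z = Out a z ⊎ Out b z
  Out (a −ₑ b) z = Out a z

  OutSymDiff : Expr S → Expr S → Var → Set
  OutSymDiff a b z = (Out a z × ¬ Out b z) ⊎ (Out b z × ¬ Out a z)

  In : Expr S → Var → Set
  In (atom R xs ys) z = z ∈ xs
  In (eqv x y) z = z ≡ x ⊎ z ≡ y
  In (eqc x c) z = z ≡ x
  In (asgv x y) z = z ≡ y
  In (asgc x c) z = ⊥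
  In (a ⨾ b) z = In a z ⊎ (In b z × ¬ Out a z)
  In (a ∪ₑ b) z = In a z ⊎ In b z ⊎ OutSymDiff a b z
  In (a −ₑ b) z = In a z ⊎ In b z ⊎ OutSymDiff a b z

  ioDisjointHere : Expr S → Set
  ioDisjointHere a = ∀ z → ¬ (In a z × Out a z)

  IoDisjoint : Expr S → Set
  IoDisjoint a@(atom _ _ _) = ioDisjointHere a
  IoDisjoint a@(eqv _ _) = ioDisjointHere a
  IoDisjoint a@(eqc _ _) = ioDisjointHere a
  IoDisjoint a@(asgv _ _) = ioDisjointHere a
  IoDisjoint a@(asgc _ _) = ioDisjointHere a
  IoDisjoint (a ⨾ b) = ioDisjointHere (a ⨾ b) × IoDisjoint a × IoDisjoint b
  IoDisjoint (a ∪ₑ b) = ioDisjointHere (a ∪ₑ b) × IoDisjoint a × IoDisjoint b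
  IoDisjoint (a −ₑ b) = ioDisjointHere (a −ₑ b) × IoDisjoint a × IoDisjoint b

-- A 𝕍-valuation (𝕍 ⊆ Var given as a predicate) is represented by a
-- total map Var → Dom whose values outside 𝕍 are irrelevant: the semantics
-- below only ever constrains values at variables of 𝕍 (or of the expression,
-- which will lie in 𝕍), so two total maps agreeing on 𝕍 are interchangeable.
Val : Set
Val = Var → Dom

⟦_⟧ : {S : Schema} → Expr S → (𝕍 : Var → Set) → Instance S → Val → Val → Set
⟦ atom R xs ys ⟧ 𝕍 D ν₁ ν₂ =
  D R (map ν₁ xs ++ map ν₂ ys) × (∀ z → 𝕍 z → ¬ z ∈ ys → ν₁ z ≡ ν₂ z)
⟦ eqv x y ⟧ 𝕍 D ν₁ ν₂ = ν₁ x ≡ ν₁ y × (∀ z → 𝕍 z → ν₁ z ≡ ν₂ z)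
⟦ eqc x c ⟧ 𝕍 D ν₁ ν₂ = ν₁ x ≡ c × (∀ z → 𝕍 z → ν₁ z ≡ ν₂ z)
⟦ asgv x y ⟧ 𝕍 D ν₁ ν₂ = ν₂ x ≡ ν₁ y × (∀ z → 𝕍 z → z ≢ x → ν₁ z ≡ ν₂ z)
⟦ asgc x c ⟧ 𝕍 D ν₁ ν₂ = ν₂ x ≡ c × (∀ z → 𝕍 z → z ≢ x → ν₁ z ≡ ν₂ z)
⟦ a ⨾ b ⟧ 𝕍 D ν₁ ν₂ = ∃ λ ν → ⟦ a ⟧ 𝕍 D ν₁ ν × ⟦ b ⟧ 𝕍 D ν ν₂
⟦ a ∪ₑ b ⟧ 𝕍 D ν₁ ν₂ = ⟦ a ⟧ 𝕍 D ν₁ ν₂ ⊎ ⟦ b ⟧ 𝕍 D ν₁ ν₂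
⟦ a −ₑ b ⟧ 𝕍 D ν₁ ν₂ = ⟦ a ⟧ 𝕍 D ν₁ ν₂ × ¬ ⟦ b ⟧ 𝕍 D ν₁ ν₂

-- β is built by structural recursion on α, reading every input y at a copy σ y, writing every
-- output x at ρ x and using temporaries from an injective supply of variables that occur nowhere
-- else; keeping these three families apart is what makes every subexpression io-disjoint. In a
-- composition a ⨾ b the outputs of a that b overwrites are parked in temporaries, and b reads
-- the outputs of a where a left them. Each branch of a union is padded with copies ρ x := σ x
-- of the inputs that only the other branch writes and with resets of the other branch's
-- temporaries, so that both branches have the same outputs. For a difference a − b, the
-- subtrahend runs a and then b with its outputs redirected to fresh variables, and equality
-- tests check that b reproduced the result of a.

module Submission where

open import Defs
open import Data.Bool using (if_then_else_)
open import Data.Empty using (⊥-elim)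
open import Data.Nat using (ℕ; suc; _+_; _*_; _≟_; s≤s)
open import Data.List.Membership.DecPropositional _≟_ using (_∈?_)
open import Data.List as L using (List; []; _∷_; _++_; filter)
open import Data.List.Membership.Propositional using () renaming (_∈_ to _∈ₗ_)
open import Data.List.Membership.Propositional.Properties
  using (∈-map⁺; ∈-map⁻; ∈-++⁺ˡ; ∈-++⁺ʳ; ∈-++⁻; ∈-filter⁺; ∈-filter⁻)
open import Data.List.Extrema.Nat using (max; xs≤max)
open import Data.List.Relation.Unary.All as All using (All; []; _∷_)
open import Data.List.Relation.Unary.Any using (Any; here; there)
open import Data.Nat.Properties
  using (+-cancelˡ-≡; *-cancelˡ-≡; even≢odd; suc-injective; m≤m+n; ≤-trans; <⇒≢)
open import Data.Product using (Σ; ∃; _×_; _,_; proj₁; proj₂)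
open import Data.Sum as Sum using (_⊎_; inj₁; inj₂; [_,_]; swap)
open import Data.Vec as V using (Vec; []; _∷_)
open import Data.Vec.Membership.Propositional using (_∈_)
open import Data.Vec.Membership.Propositional.Properties using (∈-toList⁺; ∈-toList⁻)
  renaming (∈-map⁺ to ∈ᵥ-map⁺)
open import Data.Vec.Properties using (map-∘; map-id; toList-map)
open import Data.Vec.Relation.Unary.Any using (here; there; any?)
open import Function.Base using (id)
open import Function.Bundles using (_⇔_; mk⇔)
open import Function.Definitions using (Injective)
open import Relation.Nullary using (¬_; Dec; yes; no; does)
open import Relation.Nullary.Decidable using (¬?; _⊎-dec_; dec-true; dec-false)
open import Relation.Binary.PropositionalEquality
  using (_≡_; _≢_; refl; sym; trans; cong; cong₂; subst; module ≡-Reasoning)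

private
  variable
    n : ℕ

map-cong-∈ : {A : Set} {f g : Var → A} (xs : Vec Var n) → (∀ z → z ∈ xs → f z ≡ g z) → V.map f xs ≡ V.map g xs
map-cong-∈ [] f≗g = refl
map-cong-∈ (x ∷ xs) f≗g = cong₂ _∷_ (f≗g x (here refl)) (map-cong-∈ xs (λ z z∈ → f≗g z (there z∈)))

∈ᵥ-map⁻ : ∀ {z} (f : Var → Var) (xs : Vec Var n) → z ∈ V.map f xs → ∃ λ y → y ∈ xs × z ≡ f y
∈ᵥ-map⁻ f xs z∈ with ∈-map⁻ f (subst (_ ∈ₗ_) (toList-map f xs) (∈-toList⁺ z∈))
... | y , y∈ , z≡fy = y , ∈-toList⁻ y∈ , z≡fy

module _ {S : Schema} where

  Out? : (α : Expr S) (z : Var) → Dec (Out α z)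
  Out? (atom R xs ys) z = any? (z ≟_) ys
  Out? (eqv x y) z = no λ ()
  Out? (eqc x c) z = no λ ()
  Out? (asgv x y) z = z ≟ x
  Out? (asgc x c) z = z ≟ x
  Out? (a ⨾ b) z = Out? a z ⊎-dec Out? b z
  Out? (a ∪ₑ b) z = Out? a z ⊎-dec Out? b z
  Out? (a −ₑ b) z = Out? a z

  outputs : Expr S → List Var
  outputs (atom R xs ys) = V.toList ys
  outputs (eqv x y) = []
  outputs (eqc x c) = []
  outputs (asgv x y) = x ∷ []
  outputs (asgc x c) = x ∷ []
  outputs (a ⨾ b) = outputs a ++ outputs b
  outputs (a ∪ₑ b) = outputs a ++ outputs b
  outputs (a −ₑ b) = outputs a

  ∈-outputs⁺ : ∀ (α : Expr S) {z} → Out α z → z ∈ₗ outputs α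
  ∈-outputs⁺ (atom R xs ys) z∈ = ∈-toList⁺ z∈
  ∈-outputs⁺ (asgv x y) refl = here refl
  ∈-outputs⁺ (asgc x c) refl = here refl
  ∈-outputs⁺ (a ⨾ b) (inj₁ o) = ∈-++⁺ˡ (∈-outputs⁺ a o)
  ∈-outputs⁺ (a ⨾ b) (inj₂ o) = ∈-++⁺ʳ (outputs a) (∈-outputs⁺ b o)
  ∈-outputs⁺ (a ∪ₑ b) (inj₁ o) = ∈-++⁺ˡ (∈-outputs⁺ a o)
  ∈-outputs⁺ (a ∪ₑ b) (inj₂ o) = ∈-++⁺ʳ (outputs a) (∈-outputs⁺ b o)
  ∈-outputs⁺ (a −ₑ b) o = ∈-outputs⁺ a o

  ∈-outputs⁻ : ∀ (α : Expr S) {z} → z ∈ₗ outputs α → Out α z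
  ∈-outputs⁻ (atom R xs ys) z∈ = ∈-toList⁻ z∈
  ∈-outputs⁻ (asgv x y) (here z≡x) = z≡x
  ∈-outputs⁻ (asgc x c) (here z≡x) = z≡x
  ∈-outputs⁻ (a ⨾ b) z∈ = Sum.map (∈-outputs⁻ a) (∈-outputs⁻ b) (∈-++⁻ (outputs a) z∈)
  ∈-outputs⁻ (a ∪ₑ b) z∈ = Sum.map (∈-outputs⁻ a) (∈-outputs⁻ b) (∈-++⁻ (outputs a) z∈)
  ∈-outputs⁻ (a −ₑ b) z∈ = ∈-outputs⁻ a z∈

  variables : Expr S → List Var
  variables (atom R xs ys) = V.toList xs ++ V.toList ys
  variables (eqv x y) = x ∷ y ∷ []
  variables (eqc x c) = x ∷ []
  variables (asgv x y) = x ∷ y ∷ []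
  variables (asgc x c) = x ∷ []
  variables (a ⨾ b) = variables a ++ variables b
  variables (a ∪ₑ b) = variables a ++ variables b
  variables (a −ₑ b) = variables a ++ variables b

  ∈-variables⁺ : ∀ (α : Expr S) {z} → vars α z → z ∈ₗ variables α
  ∈-variables⁺ (atom R xs ys) (inj₁ z∈) = ∈-++⁺ˡ (∈-toList⁺ z∈)
  ∈-variables⁺ (atom R xs ys) (inj₂ z∈) = ∈-++⁺ʳ (V.toList xs) (∈-toList⁺ z∈)
  ∈-variables⁺ (eqv x y) (inj₁ refl) = here refl
  ∈-variables⁺ (eqv x y) (inj₂ refl) = there (here refl)
  ∈-variables⁺ (eqc x c) refl = here refl
  ∈-variables⁺ (asgv x y) (inj₁ refl) = here refl
  ∈-variables⁺ (asgv x y) (inj₂ refl) = there (here refl)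
  ∈-variables⁺ (asgc x c) refl = here refl
  ∈-variables⁺ (a ⨾ b) (inj₁ v) = ∈-++⁺ˡ (∈-variables⁺ a v)
  ∈-variables⁺ (a ⨾ b) (inj₂ v) = ∈-++⁺ʳ (variables a) (∈-variables⁺ b v)
  ∈-variables⁺ (a ∪ₑ b) (inj₁ v) = ∈-++⁺ˡ (∈-variables⁺ a v)
  ∈-variables⁺ (a ∪ₑ b) (inj₂ v) = ∈-++⁺ʳ (variables a) (∈-variables⁺ b v)
  ∈-variables⁺ (a −ₑ b) (inj₁ v) = ∈-++⁺ˡ (∈-variables⁺ a v)
  ∈-variables⁺ (a −ₑ b) (inj₂ v) = ∈-++⁺ʳ (variables a) (∈-variables⁺ b v)

  Out⊆vars : ∀ (α : Expr S) {z} → Out α z → vars α z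
  Out⊆vars (atom R xs ys) o = inj₂ o
  Out⊆vars (asgv x y) o = inj₁ o
  Out⊆vars (asgc x c) o = o
  Out⊆vars (a ⨾ b) o = Sum.map (Out⊆vars a) (Out⊆vars b) o
  Out⊆vars (a ∪ₑ b) o = Sum.map (Out⊆vars a) (Out⊆vars b) o
  Out⊆vars (a −ₑ b) o = inj₁ (Out⊆vars a o)

  In⊆vars-binary : ∀ a b {z} → (In a z → vars a z) → (In b z → vars b z)
    → In a z ⊎ In b z ⊎ OutSymDiff a b z → vars a z ⊎ vars b z
  In⊆vars-binary a b ia ib (inj₁ i) = inj₁ (ia i)
  In⊆vars-binary a b ia ib (inj₂ (inj₁ i)) = inj₂ (ib i)
  In⊆vars-binary a b ia ib (inj₂ (inj₂ (inj₁ (o , _)))) = inj₁ (Out⊆vars a o)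
  In⊆vars-binary a b ia ib (inj₂ (inj₂ (inj₂ (o , _)))) = inj₂ (Out⊆vars b o)

  In⊆vars : ∀ (α : Expr S) {z} → In α z → vars α z
  In⊆vars (atom R xs ys) i = inj₁ i
  In⊆vars (eqv x y) i = i
  In⊆vars (eqc x c) i = i
  In⊆vars (asgv x y) i = inj₂ i
  In⊆vars (a ⨾ b) (inj₁ i) = inj₁ (In⊆vars a i)
  In⊆vars (a ⨾ b) (inj₂ (i , _)) = inj₂ (In⊆vars b i)
  In⊆vars (a ∪ₑ b) i = In⊆vars-binary a b (In⊆vars a) (In⊆vars b) i
  In⊆vars (a −ₑ b) i = In⊆vars-binary a b (In⊆vars a) (In⊆vars b) i

  IoDisjoint⇒ioDisjointHere : ∀ (α : Expr S) → IoDisjoint α → ioDisjointHere α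
  IoDisjoint⇒ioDisjointHere (atom R xs ys) io = io
  IoDisjoint⇒ioDisjointHere (eqv x y) io = io
  IoDisjoint⇒ioDisjointHere (eqc x c) io = io
  IoDisjoint⇒ioDisjointHere (asgv x y) io = io
  IoDisjoint⇒ioDisjointHere (asgc x c) io = io
  IoDisjoint⇒ioDisjointHere (a ⨾ b) io = proj₁ io
  IoDisjoint⇒ioDisjointHere (a ∪ₑ b) io = proj₁ io
  IoDisjoint⇒ioDisjointHere (a −ₑ b) io = proj₁ io

update : Val → Var → Dom → Val
update ν x c z = if does (z ≟ x) then c else ν z

update-same : ∀ ν x c → update ν x c x ≡ c
update-same ν x c rewrite dec-true (x ≟ x) refl = refl

update-other : ∀ ν x c {z} → z ≢ x → update ν x c z ≡ ν z
update-other ν x c {z} z≢x rewrite dec-false (z ≟ x) z≢x = refl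

updateAlong : Val → (Var → Var) → List Var → (Var → Dom) → Val
updateAlong ν f [] c = ν
updateAlong ν f (x ∷ xs) c = update (updateAlong ν f xs c) (f x) (c x)

updateAlong-∈ : ∀ ν f xs c {x} → (∀ a b → a ∈ₗ xs → b ∈ₗ xs → f a ≡ f b → a ≡ b)
  → x ∈ₗ xs → updateAlong ν f xs c (f x) ≡ c x
updateAlong-∈ ν f (x ∷ xs) c f-inj (here refl) = update-same (updateAlong ν f xs c) (f x) (c x)
updateAlong-∈ ν f (x′ ∷ xs) c {x} f-inj (there x∈) with f x ≟ f x′
... | yes fx≡fx′ rewrite fx≡fx′ | f-inj x x′ (there x∈) (here refl) fx≡fx′ =
  update-same (updateAlong ν f xs c) (f x′) (c x′)
... | no fx≢fx′ = trans (update-other (updateAlong ν f xs c) (f x′) (c x′) fx≢fx′)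
                    (updateAlong-∈ ν f xs c (λ a b a∈ b∈ → f-inj a b (there a∈) (there b∈)) x∈)

updateAlong-∉ : ∀ ν f xs c {z} → ¬ z ∈ₗ L.map f xs → updateAlong ν f xs c z ≡ ν z
updateAlong-∉ ν f [] c z∉ = refl
updateAlong-∉ ν f (x ∷ xs) c z∉ =
  trans (update-other (updateAlong ν f xs c) (f x) (c x) (λ z≡fx → z∉ (here z≡fx)))
        (updateAlong-∉ ν f xs c (λ z∈ → z∉ (there z∈)))

module Semantics {S : Schema} (𝕍 : Var → Set) (D : Instance S) where

  _≈_ : Val → Val → Set
  ν ≈ μ = ∀ z → 𝕍 z → ν z ≡ μ z

  ⟦⟧-resp-≈ : ∀ (α : Expr S) → (∀ z → vars α z → 𝕍 z) → ∀ {ν₁ ν₂ ν₃}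
    → ⟦ α ⟧ 𝕍 D ν₁ ν₂ → ν₂ ≈ ν₃ → ⟦ α ⟧ 𝕍 D ν₁ ν₃
  ⟦⟧-resp-≈ (atom R xs ys) ⊆𝕍 {ν₁} {ν₂} {ν₃} (d , frame) ν₂≈ν₃ =
    subst (λ w → D R (V.map ν₁ xs V.++ w)) (map-cong-∈ ys (λ z z∈ → ν₂≈ν₃ z (⊆𝕍 z (inj₂ z∈)))) d ,
    λ z z∈𝕍 z∉ → trans (frame z z∈𝕍 z∉) (ν₂≈ν₃ z z∈𝕍)
  ⟦⟧-resp-≈ (eqv x y) ⊆𝕍 (e , frame) ν₂≈ν₃ = e , λ z z∈𝕍 → trans (frame z z∈𝕍) (ν₂≈ν₃ z z∈𝕍)
  ⟦⟧-resp-≈ (eqc x c) ⊆𝕍 (e , frame) ν₂≈ν₃ = e , λ z z∈𝕍 → trans (frame z z∈𝕍) (ν₂≈ν₃ z z∈𝕍)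
  ⟦⟧-resp-≈ (asgv x y) ⊆𝕍 (e , frame) ν₂≈ν₃ =
    trans (sym (ν₂≈ν₃ x (⊆𝕍 x (inj₁ refl)))) e , λ z z∈𝕍 z≢x → trans (frame z z∈𝕍 z≢x) (ν₂≈ν₃ z z∈𝕍)
  ⟦⟧-resp-≈ (asgc x c) ⊆𝕍 (e , frame) ν₂≈ν₃ =
    trans (sym (ν₂≈ν₃ x (⊆𝕍 x refl))) e , λ z z∈𝕍 z≢x → trans (frame z z∈𝕍 z≢x) (ν₂≈ν₃ z z∈𝕍)
  ⟦⟧-resp-≈ (a ⨾ b) ⊆𝕍 (ν , ⟦a⟧ , ⟦b⟧) ν₂≈ν₃ = ν , ⟦a⟧ , ⟦⟧-resp-≈ b (λ z v → ⊆𝕍 z (inj₂ v)) ⟦b⟧ ν₂≈ν₃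
  ⟦⟧-resp-≈ (a ∪ₑ b) ⊆𝕍 (inj₁ ⟦a⟧) ν₂≈ν₃ = inj₁ (⟦⟧-resp-≈ a (λ z v → ⊆𝕍 z (inj₁ v)) ⟦a⟧ ν₂≈ν₃)
  ⟦⟧-resp-≈ (a ∪ₑ b) ⊆𝕍 (inj₂ ⟦b⟧) ν₂≈ν₃ = inj₂ (⟦⟧-resp-≈ b (λ z v → ⊆𝕍 z (inj₂ v)) ⟦b⟧ ν₂≈ν₃)
  ⟦⟧-resp-≈ (a −ₑ b) ⊆𝕍 (⟦a⟧ , ¬⟦b⟧) ν₂≈ν₃ =
    ⟦⟧-resp-≈ a (λ z v → ⊆𝕍 z (inj₁ v)) ⟦a⟧ ν₂≈ν₃ ,
    λ ⟦b⟧ → ¬⟦b⟧ (⟦⟧-resp-≈ b (λ z v → ⊆𝕍 z (inj₂ v)) ⟦b⟧ (λ z z∈𝕍 → sym (ν₂≈ν₃ z z∈𝕍)))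

  ⟦⟧-frame : ∀ (α : Expr S) {ν₁ ν₂} → ⟦ α ⟧ 𝕍 D ν₁ ν₂ → ∀ z → 𝕍 z → ¬ Out α z → ν₁ z ≡ ν₂ z
  ⟦⟧-frame (atom R xs ys) (_ , frame) z z∈𝕍 z∉ = frame z z∈𝕍 z∉
  ⟦⟧-frame (eqv x y) (_ , frame) z z∈𝕍 z∉ = frame z z∈𝕍
  ⟦⟧-frame (eqc x c) (_ , frame) z z∈𝕍 z∉ = frame z z∈𝕍
  ⟦⟧-frame (asgv x y) (_ , frame) z z∈𝕍 z∉ = frame z z∈𝕍 z∉
  ⟦⟧-frame (asgc x c) (_ , frame) z z∈𝕍 z∉ = frame z z∈𝕍 z∉
  ⟦⟧-frame (a ⨾ b) (ν , ⟦a⟧ , ⟦b⟧) z z∈𝕍 z∉ =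
    trans (⟦⟧-frame a ⟦a⟧ z z∈𝕍 (λ o → z∉ (inj₁ o))) (⟦⟧-frame b ⟦b⟧ z z∈𝕍 (λ o → z∉ (inj₂ o)))
  ⟦⟧-frame (a ∪ₑ b) (inj₁ ⟦a⟧) z z∈𝕍 z∉ = ⟦⟧-frame a ⟦a⟧ z z∈𝕍 (λ o → z∉ (inj₁ o))
  ⟦⟧-frame (a ∪ₑ b) (inj₂ ⟦b⟧) z z∈𝕍 z∉ = ⟦⟧-frame b ⟦b⟧ z z∈𝕍 (λ o → z∉ (inj₂ o))
  ⟦⟧-frame (a −ₑ b) (⟦a⟧ , _) z z∈𝕍 z∉ = ⟦⟧-frame a ⟦a⟧ z z∈𝕍 z∉

module _ {S : Schema} where

  seqAll : Expr S → List (Expr S) → Expr S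
  seqAll e [] = e
  seqAll e (a ∷ as) = seqAll (e ⨾ a) as

  OutAny InAny VarsAny : List (Expr S) → Var → Set
  OutAny as z = Any (λ a → Out a z) as
  InAny as z = Any (λ a → In a z) as
  VarsAny as z = Any (λ a → vars a z) as

  Out-seqAll⁻ : ∀ e as {z} → Out (seqAll e as) z → Out e z ⊎ OutAny as z
  Out-seqAll⁻ e [] o = inj₁ o
  Out-seqAll⁻ e (a ∷ as) o with Out-seqAll⁻ (e ⨾ a) as o
  ... | inj₁ (inj₁ o) = inj₁ o
  ... | inj₁ (inj₂ o) = inj₂ (here o)
  ... | inj₂ o = inj₂ (there o)

  Out-seqAll⁺ : ∀ e as {z} → Out e z ⊎ OutAny as z → Out (seqAll e as) z
  Out-seqAll⁺ e [] (inj₁ o) = o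
  Out-seqAll⁺ e (a ∷ as) (inj₁ o) = Out-seqAll⁺ (e ⨾ a) as (inj₁ (inj₁ o))
  Out-seqAll⁺ e (a ∷ as) (inj₂ (here o)) = Out-seqAll⁺ (e ⨾ a) as (inj₁ (inj₂ o))
  Out-seqAll⁺ e (a ∷ as) (inj₂ (there o)) = Out-seqAll⁺ (e ⨾ a) as (inj₂ o)

  In-seqAll⁻ : ∀ e as {z} → In (seqAll e as) z → In e z ⊎ (InAny as z × ¬ Out e z)
  In-seqAll⁻ e [] i = inj₁ i
  In-seqAll⁻ e (a ∷ as) i with In-seqAll⁻ (e ⨾ a) as i
  ... | inj₁ (inj₁ i) = inj₁ i
  ... | inj₁ (inj₂ (i , ¬o)) = inj₂ (here i , ¬o)
  ... | inj₂ (i , ¬o) = inj₂ (there i , λ o → ¬o (inj₁ o))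

  In-seqAll⁺ : ∀ e as → (∀ z → InAny as z → ¬ OutAny as z)
    → ∀ {z} → In e z ⊎ (InAny as z × ¬ Out e z) → In (seqAll e as) z
  In-seqAll⁺ e [] io (inj₁ i) = i
  In-seqAll⁺ e (a ∷ as) io (inj₁ i) =
    In-seqAll⁺ (e ⨾ a) as (λ z i o → io z (there i) (there o)) (inj₁ (inj₁ i))
  In-seqAll⁺ e (a ∷ as) io (inj₂ (here i , ¬o)) =
    In-seqAll⁺ (e ⨾ a) as (λ z i o → io z (there i) (there o)) (inj₁ (inj₂ (i , ¬o)))
  In-seqAll⁺ e (a ∷ as) io {z} (inj₂ (there i , ¬o)) =
    In-seqAll⁺ (e ⨾ a) as (λ z i o → io z (there i) (there o)) (inj₂ (i , [ ¬o , (λ o → io z (there i) (here o)) ]))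

  vars-seqAll⁺ : ∀ e as {z} → vars e z ⊎ VarsAny as z → vars (seqAll e as) z
  vars-seqAll⁺ e [] (inj₁ v) = v
  vars-seqAll⁺ e (a ∷ as) (inj₁ v) = vars-seqAll⁺ (e ⨾ a) as (inj₁ (inj₁ v))
  vars-seqAll⁺ e (a ∷ as) (inj₂ (here v)) = vars-seqAll⁺ (e ⨾ a) as (inj₁ (inj₂ v))
  vars-seqAll⁺ e (a ∷ as) (inj₂ (there v)) = vars-seqAll⁺ (e ⨾ a) as (inj₂ v)

  IoDisjoint-seqAll : ∀ e as → IoDisjoint e → All IoDisjoint as
    → (∀ z → InAny as z → ¬ OutAny as z) → (∀ z → In e z → ¬ OutAny as z) → IoDisjoint (seqAll e as)
  IoDisjoint-seqAll e [] io-e [] _ _ = io-e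
  IoDisjoint-seqAll e (a ∷ as) io-e (io-a ∷ io-as) io-as′ e↛as =
    IoDisjoint-seqAll (e ⨾ a) as (io-ea , io-e , io-a) io-as
      (λ z i o → io-as′ z (there i) (there o))
      (λ z → [ (λ i o → e↛as z i (there o)) , (λ { (i , _) o → io-as′ z (here i) (there o) }) ])
    where
    io-ea : ioDisjointHere (e ⨾ a)
    io-ea z (inj₁ i , inj₁ o) = IoDisjoint⇒ioDisjointHere e io-e z (i , o)
    io-ea z (inj₁ i , inj₂ o) = e↛as z i (here o)
    io-ea z (inj₂ (i , ¬o) , inj₁ o) = ¬o o
    io-ea z (inj₂ (i , _) , inj₂ o) = io-as′ z (here i) (here o)

  module RunSemantics (𝕍 : Var → Set) (D : Instance S) where
    open Semantics {S = S} 𝕍 D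

    Run : List (Expr S) → Val → Val → Set
    Run [] ν μ = ν ≈ μ
    Run (a ∷ as) ν μ = ∃ λ ν′ → ⟦ a ⟧ 𝕍 D ν ν′ × Run as ν′ μ

    ⟦seqAll⟧⁻ : ∀ e as {ν₁ ν₂} → ⟦ seqAll e as ⟧ 𝕍 D ν₁ ν₂ → ∃ λ ν → ⟦ e ⟧ 𝕍 D ν₁ ν × Run as ν ν₂
    ⟦seqAll⟧⁻ e [] {ν₂ = ν₂} ⟦e⟧ = ν₂ , ⟦e⟧ , λ _ _ → refl
    ⟦seqAll⟧⁻ e (a ∷ as) ⟦s⟧ with ⟦seqAll⟧⁻ (e ⨾ a) as ⟦s⟧
    ... | ν , (ν′ , ⟦e⟧ , ⟦a⟧) , run = ν′ , ⟦e⟧ , ν , ⟦a⟧ , run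

    ⟦seqAll⟧⁺ : ∀ e as → (∀ z → vars (seqAll e as) z → 𝕍 z) → ∀ {ν₁ ν ν₂}
      → ⟦ e ⟧ 𝕍 D ν₁ ν → Run as ν ν₂ → ⟦ seqAll e as ⟧ 𝕍 D ν₁ ν₂
    ⟦seqAll⟧⁺ e [] ⊆𝕍 ⟦e⟧ run = ⟦⟧-resp-≈ e ⊆𝕍 ⟦e⟧ run
    ⟦seqAll⟧⁺ e (a ∷ as) ⊆𝕍 ⟦e⟧ (ν′ , ⟦a⟧ , run) = ⟦seqAll⟧⁺ (e ⨾ a) as ⊆𝕍 (_ , ⟦e⟧ , ⟦a⟧) run

module _ {S : Schema} where

  assignments : (f g : Var → Var) → List Var → List (Expr S)
  assignments f g = L.map (λ x → asgv (f x) (g x))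

  -- The constant 0 is arbitrary: resets only serve to make the output sets of two branches equal.
  resets : List Var → List (Expr S)
  resets = L.map (λ x → asgc x 0)

  equalities : List (Var × Var) → List (Expr S)
  equalities = L.map (λ { (p , q) → eqv p q })

  Out-assignments⁻ : ∀ f g xs {z} → OutAny (assignments f g xs) z → z ∈ₗ L.map f xs
  Out-assignments⁻ f g (x ∷ xs) (here e) = here e
  Out-assignments⁻ f g (x ∷ xs) (there o) = there (Out-assignments⁻ f g xs o)

  Out-assignments⁺ : ∀ f g xs {z} → z ∈ₗ L.map f xs → OutAny (assignments f g xs) z
  Out-assignments⁺ f g (x ∷ xs) (here e) = here e
  Out-assignments⁺ f g (x ∷ xs) (there z∈) = there (Out-assignments⁺ f g xs z∈)

  In-assignments⁻ : ∀ f g xs {z} → InAny (assignments f g xs) z → z ∈ₗ L.map g xs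
  In-assignments⁻ f g (x ∷ xs) (here e) = here e
  In-assignments⁻ f g (x ∷ xs) (there i) = there (In-assignments⁻ f g xs i)

  In-assignments⁺ : ∀ f g xs {z} → z ∈ₗ L.map g xs → InAny (assignments f g xs) z
  In-assignments⁺ f g (x ∷ xs) (here e) = here e
  In-assignments⁺ f g (x ∷ xs) (there z∈) = there (In-assignments⁺ f g xs z∈)

  vars-assignments-target : ∀ f g xs {z} → z ∈ₗ L.map f xs → VarsAny (assignments f g xs) z
  vars-assignments-target f g (x ∷ xs) (here e) = here (inj₁ e)
  vars-assignments-target f g (x ∷ xs) (there z∈) = there (vars-assignments-target f g xs z∈)

  vars-assignments-source : ∀ f g xs {z} → z ∈ₗ L.map g xs → VarsAny (assignments f g xs) z
  vars-assignments-source f g (x ∷ xs) (here e) = here (inj₂ e)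
  vars-assignments-source f g (x ∷ xs) (there z∈) = there (vars-assignments-source f g xs z∈)

  IoDisjoint-assignments : ∀ f g xs → (∀ x → x ∈ₗ xs → g x ≢ f x) → All IoDisjoint (assignments f g xs)
  IoDisjoint-assignments f g [] g≢f = []
  IoDisjoint-assignments f g (x ∷ xs) g≢f =
    (λ { z (z≡gx , z≡fx) → g≢f x (here refl) (trans (sym z≡gx) z≡fx) }) ∷
    IoDisjoint-assignments f g xs (λ x′ x′∈ → g≢f x′ (there x′∈))

  Out-resets⁻ : ∀ xs {z} → OutAny (resets xs) z → z ∈ₗ xs
  Out-resets⁻ (x ∷ xs) (here e) = here e
  Out-resets⁻ (x ∷ xs) (there o) = there (Out-resets⁻ xs o)

  Out-resets⁺ : ∀ xs {z} → z ∈ₗ xs → OutAny (resets xs) z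
  Out-resets⁺ (x ∷ xs) (here e) = here e
  Out-resets⁺ (x ∷ xs) (there z∈) = there (Out-resets⁺ xs z∈)

  ¬In-resets : ∀ xs {z} → ¬ InAny (resets xs) z
  ¬In-resets (x ∷ xs) (there i) = ¬In-resets xs i

  vars-resets : ∀ xs {z} → z ∈ₗ xs → VarsAny (resets xs) z
  vars-resets (x ∷ xs) (here e) = here e
  vars-resets (x ∷ xs) (there z∈) = there (vars-resets xs z∈)

  IoDisjoint-resets : ∀ xs → All IoDisjoint (resets xs)
  IoDisjoint-resets [] = []
  IoDisjoint-resets (x ∷ xs) = (λ { z (() , _) }) ∷ IoDisjoint-resets xs

  ¬Out-equalities : ∀ C {z} → ¬ OutAny (equalities C) z
  ¬Out-equalities ((p , q) ∷ C) (there o) = ¬Out-equalities C o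

  In-equalities⁻ : ∀ C {z} → InAny (equalities C) z → z ∈ₗ L.map proj₁ C ⊎ z ∈ₗ L.map proj₂ C
  In-equalities⁻ ((p , q) ∷ C) (here (inj₁ e)) = inj₁ (here e)
  In-equalities⁻ ((p , q) ∷ C) (here (inj₂ e)) = inj₂ (here e)
  In-equalities⁻ ((p , q) ∷ C) (there i) = Sum.map there there (In-equalities⁻ C i)

  In-equalities⁺ : ∀ C {z} → z ∈ₗ L.map proj₂ C → InAny (equalities C) z
  In-equalities⁺ ((p , q) ∷ C) (here e) = here (inj₂ e)
  In-equalities⁺ ((p , q) ∷ C) (there z∈) = there (In-equalities⁺ C z∈)

  vars-equalities : ∀ C {z} → z ∈ₗ L.map proj₁ C ⊎ z ∈ₗ L.map proj₂ C → VarsAny (equalities C) z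
  vars-equalities ((p , q) ∷ C) (inj₁ (here e)) = here (inj₁ e)
  vars-equalities ((p , q) ∷ C) (inj₂ (here e)) = here (inj₂ e)
  vars-equalities ((p , q) ∷ C) (inj₁ (there z∈)) = there (vars-equalities C (inj₁ z∈))
  vars-equalities ((p , q) ∷ C) (inj₂ (there z∈)) = there (vars-equalities C (inj₂ z∈))

  IoDisjoint-equalities : ∀ C → All IoDisjoint (equalities C)
  IoDisjoint-equalities [] = []
  IoDisjoint-equalities ((p , q) ∷ C) = (λ { z (_ , ()) }) ∷ IoDisjoint-equalities C

  module BlockRuns (𝕍 : Var → Set) (D : Instance S) where
    open Semantics {S = S} 𝕍 D
    open RunSemantics {S = S} 𝕍 D

    record Copyable (f g : Var → Var) (xs : List Var) : Set where
      field
        target∈𝕍 : ∀ x → x ∈ₗ xs → 𝕍 (f x)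
        source∈𝕍 : ∀ x → x ∈ₗ xs → 𝕍 (g x)
        target-injective : ∀ a b → a ∈ₗ xs → b ∈ₗ xs → f a ≡ f b → a ≡ b
        source≢target : ∀ a b → a ∈ₗ xs → b ∈ₗ xs → g a ≢ f b

    Copyable-tail : ∀ {f g x xs} → Copyable f g (x ∷ xs) → Copyable f g xs
    Copyable-tail ok = record
      { target∈𝕍 = λ a a∈ → target∈𝕍 a (there a∈)
      ; source∈𝕍 = λ a a∈ → source∈𝕍 a (there a∈)
      ; target-injective = λ a b a∈ b∈ → target-injective a b (there a∈) (there b∈)
      ; source≢target = λ a b a∈ b∈ → source≢target a b (there a∈) (there b∈)
      }
      where open Copyable ok

    CopiedFrom : (f g : Var → Var) (xs : List Var) → Val → Val → Set
    CopiedFrom f g xs ν μ = (∀ x → x ∈ₗ xs → μ (f x) ≡ ν (g x)) × (∀ z → 𝕍 z → ¬ z ∈ₗ L.map f xs → ν z ≡ μ z)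

    CopiedFrom-∷ : ∀ f g x xs {ν ν′ μ} → Copyable f g (x ∷ xs)
      → ν′ (f x) ≡ ν (g x) → (∀ z → 𝕍 z → z ≢ f x → ν z ≡ ν′ z)
      → CopiedFrom f g xs ν′ μ → CopiedFrom f g (x ∷ xs) ν μ
    CopiedFrom-∷ f g x xs {ν} {ν′} {μ} ok copied frame (copies , rest) = copies′ , rest′
      where
      open Copyable ok
      copies′ : ∀ x′ → x′ ∈ₗ x ∷ xs → μ (f x′) ≡ ν (g x′)
      copies′ x′ (there x′∈) =
        trans (copies x′ x′∈)
              (sym (frame (g x′) (source∈𝕍 x′ (there x′∈)) (source≢target x′ x (there x′∈) (here refl))))
      copies′ x′ (here refl) with f x ∈? L.map f xs
      ... | no fx∉ = trans (sym (rest (f x) (target∈𝕍 x (here refl)) fx∉)) copied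
      ... | yes fx∈ with ∈-map⁻ f fx∈
      ...   | x″ , x″∈ , fx≡fx″ with target-injective x x″ (here refl) (there x″∈) fx≡fx″
      ...     | refl = copies′ x (there x″∈)
      rest′ : ∀ z → 𝕍 z → ¬ z ∈ₗ L.map f (x ∷ xs) → ν z ≡ μ z
      rest′ z z∈𝕍 z∉ = trans (frame z z∈𝕍 (λ e → z∉ (here e))) (rest z z∈𝕍 (λ z∈ → z∉ (there z∈)))

    run-assignments⁻ : ∀ f g xs {ν μ} → Copyable f g xs → Run (assignments f g xs) ν μ → CopiedFrom f g xs ν μ
    run-assignments⁻ f g [] ok run = (λ _ ()) , λ z z∈𝕍 _ → run z z∈𝕍
    run-assignments⁻ f g (x ∷ xs) ok (ν′ , (copied , frame) , run) =
      CopiedFrom-∷ f g x xs ok copied frame (run-assignments⁻ f g xs (Copyable-tail ok) run)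

    run-assignments⁺ : ∀ f g xs ν → Copyable f g xs → ∃ λ μ → Run (assignments f g xs) ν μ × CopiedFrom f g xs ν μ
    run-assignments⁺ f g [] ν ok = ν , (λ _ _ → refl) , (λ _ ()) , λ _ _ _ → refl
    run-assignments⁺ f g (x ∷ xs) ν ok
      with run-assignments⁺ f g xs (update ν (f x) (ν (g x))) (Copyable-tail ok)
    ... | μ , run , copiedFrom =
      μ , (_ , (copied , frame) , run) , CopiedFrom-∷ f g x xs ok copied frame copiedFrom
      where
      copied = update-same ν (f x) (ν (g x))
      frame = λ z _ z≢fx → sym (update-other ν (f x) (ν (g x)) z≢fx)

    Reset : List Var → Val → Val → Set
    Reset xs ν μ = (∀ z → z ∈ₗ xs → μ z ≡ 0) × (∀ z → 𝕍 z → ¬ z ∈ₗ xs → ν z ≡ μ z)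

    Reset-∷ : ∀ x xs {ν ν′ μ} → 𝕍 x → ν′ x ≡ 0 → (∀ z → 𝕍 z → z ≢ x → ν z ≡ ν′ z)
      → Reset xs ν′ μ → Reset (x ∷ xs) ν μ
    Reset-∷ x xs {ν} {ν′} {μ} x∈𝕍 reset frame (zeroed , rest) = zeroed′ , rest′
      where
      zeroed′ : ∀ z → z ∈ₗ x ∷ xs → μ z ≡ 0
      zeroed′ z (there z∈) = zeroed z z∈
      zeroed′ z (here refl) with x ∈? xs
      ... | yes x∈ = zeroed x x∈
      ... | no x∉ = trans (sym (rest x x∈𝕍 x∉)) reset
      rest′ : ∀ z → 𝕍 z → ¬ z ∈ₗ x ∷ xs → ν z ≡ μ z
      rest′ z z∈𝕍 z∉ = trans (frame z z∈𝕍 (λ e → z∉ (here e))) (rest z z∈𝕍 (λ z∈ → z∉ (there z∈)))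

    run-resets⁻ : ∀ xs {ν μ} → (∀ z → z ∈ₗ xs → 𝕍 z) → Run (resets xs) ν μ → Reset xs ν μ
    run-resets⁻ [] xs⊆𝕍 run = (λ _ ()) , λ z z∈𝕍 _ → run z z∈𝕍
    run-resets⁻ (x ∷ xs) xs⊆𝕍 (ν′ , (reset , frame) , run) =
      Reset-∷ x xs (xs⊆𝕍 x (here refl)) reset frame (run-resets⁻ xs (λ z z∈ → xs⊆𝕍 z (there z∈)) run)

    run-resets⁺ : ∀ xs ν → (∀ z → z ∈ₗ xs → 𝕍 z) → ∃ λ μ → Run (resets xs) ν μ × Reset xs ν μ
    run-resets⁺ [] ν xs⊆𝕍 = ν , (λ _ _ → refl) , (λ _ ()) , λ _ _ _ → refl
    run-resets⁺ (x ∷ xs) ν xs⊆𝕍 with run-resets⁺ xs (update ν x 0) (λ z z∈ → xs⊆𝕍 z (there z∈))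
    ... | μ , run , reset-xs =
      μ , (_ , (reset , frame) , run) , Reset-∷ x xs (xs⊆𝕍 x (here refl)) reset frame reset-xs
      where
      reset = update-same ν x 0
      frame = λ z _ z≢x → sym (update-other ν x 0 z≢x)

    run-equalities⁻ : ∀ C {ν μ} → (∀ pq → pq ∈ₗ C → 𝕍 (proj₁ pq) × 𝕍 (proj₂ pq)) → Run (equalities C) ν μ
      → (∀ pq → pq ∈ₗ C → ν (proj₁ pq) ≡ ν (proj₂ pq)) × ν ≈ μ
    run-equalities⁻ [] C⊆𝕍 run = (λ _ ()) , run
    run-equalities⁻ ((p , q) ∷ C) C⊆𝕍 (ν′ , (p≡q , frame) , run)
      with run-equalities⁻ C (λ pq pq∈ → C⊆𝕍 pq (there pq∈)) run
    ... | equal , ν′≈μ = equal′ , λ z z∈𝕍 → trans (frame z z∈𝕍) (ν′≈μ z z∈𝕍)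
      where
      equal′ : ∀ pq → pq ∈ₗ (p , q) ∷ C → _ ≡ _
      equal′ _ (here refl) = p≡q
      equal′ pq (there pq∈) = trans (frame _ (proj₁ (C⊆𝕍 pq (there pq∈))))
                                (trans (equal pq pq∈) (sym (frame _ (proj₂ (C⊆𝕍 pq (there pq∈))))))

    run-equalities⁺ : ∀ C ν → (∀ pq → pq ∈ₗ C → ν (proj₁ pq) ≡ ν (proj₂ pq)) → Run (equalities C) ν ν
    run-equalities⁺ [] ν equal = λ _ _ → refl
    run-equalities⁺ ((p , q) ∷ C) ν equal =
      ν , (equal _ (here refl) , λ _ _ → refl) , run-equalities⁺ C ν (λ pq pq∈ → equal pq (there pq∈))

-- Fresh variables

evens odds : (ℕ → Var) → ℕ → Var
evens r k = r (2 * k)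
odds r k = r (suc (2 * k))

evens-injective : ∀ {r} → Injective _≡_ _≡_ r → Injective _≡_ _≡_ (evens r)
evens-injective r-inj e = *-cancelˡ-≡ _ _ 2 (r-inj e)

odds-injective : ∀ {r} → Injective _≡_ _≡_ r → Injective _≡_ _≡_ (odds r)
odds-injective r-inj e = *-cancelˡ-≡ _ _ 2 (suc-injective (r-inj e))

evens≢odds : ∀ {r} → Injective _≡_ _≡_ r → ∀ j k → evens r j ≢ odds r k
evens≢odds r-inj j k e = even≢odd j k (r-inj e)

-- The translation

module _ {S : Schema} where

  -- Outputs of the first factor that the second one overwrites are parked in temporaries.
  redirect : Expr S → (ℕ → Var) → (Var → Var) → Var → Var
  redirect b t ρ x = if does (Out? b x) then t x else ρ x

  readFrom : Expr S → (Var → Var) → (Var → Var) → Var → Var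
  readFrom a ρ₁ σ y = if does (Out? a y) then ρ₁ y else σ y

  outputsOnly : Expr S → Expr S → List Var
  outputsOnly b a = filter (λ x → ¬? (Out? a x)) (outputs b)

  -- A branch of a union: copy the inputs the branch leaves untouched but the other branch
  -- writes, and reset the temporaries of the other branch, so that both branches have the
  -- same outputs.
  padBranch : (a b : Expr S) (σ ρ : Var → Var) → Expr S → List Var → Expr S
  padBranch a b σ ρ β t = seqAll (seqAll β (assignments ρ σ (outputsOnly b a))) (resets t)

  -- Equations between the result of a and the (renamed) result of b, one for every output
  -- variable of a or b; an input that one side leaves unchanged is compared at its input copy.
  diffEquations : (a b : Expr S) (σ ρ : Var → Var) (t : Var → Var) → List (Var × Var)
  diffEquations a b σ ρ t =
    L.map (λ x → t x , ρ x) (filter (Out? a) (outputs b))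
    ++ L.map (λ x → t x , σ x) (outputsOnly b a)
    ++ L.map (λ x → ρ x , σ x) (outputsOnly a b)

  -- translate α σ ρ r reads each input y of α at σ y, writes each output x at ρ x, and
  -- returns the temporaries r k it writes besides.
  translate : Expr S → (σ ρ : Var → Var) → (ℕ → Var) → Expr S × List Var
  translate (atom R xs ys) σ ρ r = atom R (V.map σ xs) (V.map ρ ys) , []
  translate (eqv x y) σ ρ r = eqv (σ x) (σ y) , []
  translate (eqc x c) σ ρ r = eqc (σ x) c , []
  translate (asgv x y) σ ρ r = asgv (ρ x) (σ y) , []
  translate (asgc x c) σ ρ r = asgc (ρ x) c , []
  translate (a ⨾ b) σ ρ r =
    let t = odds (odds r)
        ρ₁ = redirect b t ρ
        A = translate a σ ρ₁ (evens r)
        B = translate b (readFrom a ρ₁ σ) ρ (evens (odds r))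
    in proj₁ A ⨾ proj₁ B , proj₂ A ++ proj₂ B ++ L.map t (filter (Out? b) (outputs a))
  translate (a ∪ₑ b) σ ρ r =
    let A = translate a σ ρ (evens r)
        B = translate b σ ρ (odds r)
    in padBranch a b σ ρ (proj₁ A) (proj₂ B) ∪ₑ padBranch b a σ ρ (proj₁ B) (proj₂ A) , proj₂ A ++ proj₂ B
  translate (a −ₑ b) σ ρ r =
    let t = odds (odds r)
        A = translate a σ ρ (evens r)
        B = translate b σ t (evens (odds r))
        Z = L.map t (outputs b) ++ proj₂ B
    in seqAll (proj₁ A) (resets Z)
         −ₑ seqAll (seqAll (proj₁ A ⨾ proj₁ B) (equalities (diffEquations a b σ ρ t))) (resets Z) ,
       proj₂ A ++ Z

  expr : Expr S → (σ ρ : Var → Var) → (ℕ → Var) → Expr S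
  expr α σ ρ r = proj₁ (translate α σ ρ r)

  temps : Expr S → (σ ρ : Var → Var) → (ℕ → Var) → List Var
  temps α σ ρ r = proj₂ (translate α σ ρ r)

  record Separated (α : Expr S) (σ ρ : Var → Var) (r : ℕ → Var) : Set where
    field
      ρ-injective : ∀ x y → Out α x → Out α y → ρ x ≡ ρ y → x ≡ y
      r-injective : Injective _≡_ _≡_ r
      ρ≢r : ∀ x k → Out α x → ρ x ≢ r k
      σ≢ρ : ∀ y x → In α y → Out α x → σ y ≢ ρ x
      σ≢r : ∀ y k → In α y → σ y ≢ r k

  Simulates : (α β : Expr S) (σ ρ : Var → Var) → Set₁
  Simulates α β σ ρ = ∀ (𝕍 : Var → Set) (D : Instance S) → (∀ z → vars α z → 𝕍 z) → (∀ z → vars β z → 𝕍 z)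
    → ∀ ν₁ ν₂ μ₁ → (∀ y → In α y → μ₁ (σ y) ≡ ν₁ y) → ⟦ α ⟧ 𝕍 D ν₁ ν₂
    → ∃ λ μ₂ → ⟦ β ⟧ 𝕍 D μ₁ μ₂ × (∀ x → Out α x → ν₂ x ≡ μ₂ (ρ x))

  Reflects : (α β : Expr S) (σ ρ : Var → Var) → Set₁
  Reflects α β σ ρ = ∀ (𝕍 : Var → Set) (D : Instance S) → (∀ z → vars α z → 𝕍 z) → (∀ z → vars β z → 𝕍 z)
    → ∀ ν₁ μ₁ μ₂ → (∀ y → In α y → μ₁ (σ y) ≡ ν₁ y) → ⟦ β ⟧ 𝕍 D μ₁ μ₂
    → ∃ λ ν₂ → ⟦ α ⟧ 𝕍 D ν₁ ν₂ × (∀ x → Out α x → ν₂ x ≡ μ₂ (ρ x))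

  record Correct (α : Expr S) (σ ρ : Var → Var) (r : ℕ → Var) : Set₁ where
    field
      ioDisjoint : IoDisjoint (expr α σ ρ r)
      In⊆ : ∀ z → In (expr α σ ρ r) z → ∃ λ y → In α y × z ≡ σ y
      In⊇ : ∀ y → In α y → In (expr α σ ρ r) (σ y)
      Out⊆ : ∀ z → Out (expr α σ ρ r) z → (∃ λ x → Out α x × z ≡ ρ x) ⊎ z ∈ₗ temps α σ ρ r
      Out-ρ : ∀ x → Out α x → Out (expr α σ ρ r) (ρ x)
      Out-temps : ∀ z → z ∈ₗ temps α σ ρ r → Out (expr α σ ρ r) z
      temps-fresh : ∀ z → z ∈ₗ temps α σ ρ r → ∃ λ k → z ≡ r k
      simulates : Simulates α (expr α σ ρ r) σ ρ
      reflects : Reflects α (expr α σ ρ r) σ ρ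

-- Atomic expressions

module _ {S : Schema} where

  tuple-rename : ∀ {m k} (σ ρ : Var → Var) (xs : Vec Var m) (ys : Vec Var k) {ν₁ ν₂ μ₁ μ₂ : Val}
    → (∀ y → y ∈ xs → μ₁ (σ y) ≡ ν₁ y) → (∀ x → x ∈ ys → ν₂ x ≡ μ₂ (ρ x))
    → V.map ν₁ xs V.++ V.map ν₂ ys ≡ V.map μ₁ (V.map σ xs) V.++ V.map μ₂ (V.map ρ ys)
  tuple-rename σ ρ xs ys {μ₁ = μ₁} {μ₂} in≡ out≡ =
    cong₂ V._++_ (trans (map-cong-∈ xs (λ z z∈ → sym (in≡ z z∈))) (map-∘ μ₁ σ xs))
                 (trans (map-cong-∈ ys out≡) (map-∘ μ₂ ρ ys))

  correct-atom : ∀ R xs ys σ ρ r → Separated (atom {S = S} R xs ys) σ ρ r → Correct (atom {S = S} R xs ys) σ ρ r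
  correct-atom R xs ys σ ρ r sep = record
    { ioDisjoint = λ { z (i , o) → io z i o }
    ; In⊆ = λ z i → ∈ᵥ-map⁻ σ xs i
    ; In⊇ = λ y i → ∈ᵥ-map⁺ σ i
    ; Out⊆ = λ z o → inj₁ (∈ᵥ-map⁻ ρ ys o)
    ; Out-ρ = λ x o → ∈ᵥ-map⁺ ρ o
    ; Out-temps = λ z ()
    ; temps-fresh = λ z ()
    ; simulates = simulates
    ; reflects = reflects
    }
    where
    open Separated sep
    io : ∀ z → z ∈ V.map σ xs → ¬ z ∈ V.map ρ ys
    io z i o with ∈ᵥ-map⁻ σ xs i | ∈ᵥ-map⁻ ρ ys o
    ... | y , y∈ , refl | x , x∈ , σy≡ρx = σ≢ρ y x y∈ x∈ σy≡ρx
    ρ-injective′ : ∀ a b → a ∈ₗ V.toList ys → b ∈ₗ V.toList ys → ρ a ≡ ρ b → a ≡ b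
    ρ-injective′ a b a∈ b∈ = ρ-injective a b (∈-toList⁻ a∈) (∈-toList⁻ b∈)
    ∈-map-toList⁻ : ∀ {z} (f : Var → Var) → z ∈ₗ L.map f (V.toList ys) → z ∈ V.map f ys
    ∈-map-toList⁻ f z∈ with ∈-map⁻ f z∈
    ... | x , x∈ , refl = ∈ᵥ-map⁺ f (∈-toList⁻ x∈)

    simulates : Simulates (atom {S = S} R xs ys) (atom R (V.map σ xs) (V.map ρ ys)) σ ρ
    simulates 𝕍 D _ _ ν₁ ν₂ μ₁ in≡ (d , frame) = μ₂ , (subst (D R) tuple≡ d , frame′) , λ x x∈ → sym (μ₂∘ρ≡ν₂ x x∈)
      where
      μ₂ = updateAlong μ₁ ρ (V.toList ys) ν₂
      μ₂∘ρ≡ν₂ : ∀ x → x ∈ ys → μ₂ (ρ x) ≡ ν₂ x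
      μ₂∘ρ≡ν₂ x x∈ = updateAlong-∈ μ₁ ρ (V.toList ys) ν₂ ρ-injective′ (∈-toList⁺ x∈)
      tuple≡ : V.map ν₁ xs V.++ V.map ν₂ ys ≡ V.map μ₁ (V.map σ xs) V.++ V.map μ₂ (V.map ρ ys)
      tuple≡ = tuple-rename σ ρ xs ys in≡ (λ x x∈ → sym (μ₂∘ρ≡ν₂ x x∈))
      frame′ : ∀ z → 𝕍 z → ¬ z ∈ V.map ρ ys → μ₁ z ≡ μ₂ z
      frame′ z _ z∉ = sym (updateAlong-∉ μ₁ ρ (V.toList ys) ν₂ (λ z∈ → z∉ (∈-map-toList⁻ ρ z∈)))

    reflects : Reflects (atom {S = S} R xs ys) (atom R (V.map σ xs) (V.map ρ ys)) σ ρ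
    reflects 𝕍 D _ _ ν₁ μ₁ μ₂ in≡ (d , frame) = ν₂ , (subst (D R) (sym tuple≡) d , frame′) , ν₂≡μ₂∘ρ
      where
      ν₂ = updateAlong ν₁ (λ z → z) (V.toList ys) (λ z → μ₂ (ρ z))
      ν₂≡μ₂∘ρ : ∀ x → x ∈ ys → ν₂ x ≡ μ₂ (ρ x)
      ν₂≡μ₂∘ρ x x∈ = updateAlong-∈ ν₁ (λ z → z) (V.toList ys) (λ z → μ₂ (ρ z)) (λ _ _ _ _ e → e) (∈-toList⁺ x∈)
      tuple≡ : V.map ν₁ xs V.++ V.map ν₂ ys ≡ V.map μ₁ (V.map σ xs) V.++ V.map μ₂ (V.map ρ ys)
      tuple≡ = tuple-rename σ ρ xs ys in≡ ν₂≡μ₂∘ρ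
      frame′ : ∀ z → 𝕍 z → ¬ z ∈ ys → ν₁ z ≡ ν₂ z
      frame′ z _ z∉ = sym (updateAlong-∉ ν₁ (λ z → z) (V.toList ys) (λ z → μ₂ (ρ z))
                             (λ z∈ → z∉ (subst (_ ∈_) (map-id ys) (∈-map-toList⁻ (λ z → z) z∈))))

  correct-eqv : ∀ x y σ ρ r → Correct (eqv {S = S} x y) σ ρ r
  correct-eqv x y σ ρ r = record
    { ioDisjoint = λ { z (_ , ()) }
    ; In⊆ = λ { z (inj₁ refl) → x , inj₁ refl , refl ; z (inj₂ refl) → y , inj₂ refl , refl }
    ; In⊇ = λ { _ (inj₁ refl) → inj₁ refl ; _ (inj₂ refl) → inj₂ refl }
    ; Out⊆ = λ z ()
    ; Out-ρ = λ z ()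
    ; Out-temps = λ z ()
    ; temps-fresh = λ z ()
    ; simulates = λ 𝕍 D _ _ ν₁ ν₂ μ₁ in≡ (e , _) →
        μ₁ , (trans (in≡ x (inj₁ refl)) (trans e (sym (in≡ y (inj₂ refl)))) , λ _ _ → refl) , λ _ ()
    ; reflects = λ 𝕍 D _ _ ν₁ μ₁ μ₂ in≡ (e , _) →
        ν₁ , (trans (sym (in≡ x (inj₁ refl))) (trans e (in≡ y (inj₂ refl))) , λ _ _ → refl) , λ _ ()
    }

  correct-eqc : ∀ x c σ ρ r → Correct (eqc {S = S} x c) σ ρ r
  correct-eqc x c σ ρ r = record
    { ioDisjoint = λ { z (_ , ()) }
    ; In⊆ = λ { z refl → x , refl , refl }
    ; In⊇ = λ { _ refl → refl }
    ; Out⊆ = λ z ()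
    ; Out-ρ = λ z ()
    ; Out-temps = λ z ()
    ; temps-fresh = λ z ()
    ; simulates = λ 𝕍 D _ _ ν₁ ν₂ μ₁ in≡ (e , _) → μ₁ , (trans (in≡ x refl) e , λ _ _ → refl) , λ _ ()
    ; reflects = λ 𝕍 D _ _ ν₁ μ₁ μ₂ in≡ (e , _) → ν₁ , (trans (sym (in≡ x refl)) e , λ _ _ → refl) , λ _ ()
    }

  correct-asgv : ∀ x y σ ρ r → Separated (asgv {S = S} x y) σ ρ r → Correct (asgv {S = S} x y) σ ρ r
  correct-asgv x y σ ρ r sep = record
    { ioDisjoint = λ { z (refl , e) → Separated.σ≢ρ sep y x refl refl e }
    ; In⊆ = λ { z refl → y , refl , refl }
    ; In⊇ = λ { _ refl → refl }
    ; Out⊆ = λ { z refl → inj₁ (x , refl , refl) }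
    ; Out-ρ = λ { _ refl → refl }
    ; Out-temps = λ z ()
    ; temps-fresh = λ z ()
    ; simulates = λ 𝕍 D _ _ ν₁ ν₂ μ₁ in≡ (e , _) →
        update μ₁ (ρ x) (ν₁ y) ,
        (trans (update-same μ₁ (ρ x) (ν₁ y)) (sym (in≡ y refl)) , λ z _ z≢ → sym (update-other μ₁ (ρ x) (ν₁ y) z≢)) ,
        λ { _ refl → trans e (sym (update-same μ₁ (ρ x) (ν₁ y))) }
    ; reflects = λ 𝕍 D _ _ ν₁ μ₁ μ₂ in≡ (e , _) →
        update ν₁ x (μ₂ (ρ x)) ,
        (trans (update-same ν₁ x (μ₂ (ρ x))) (trans e (in≡ y refl)) ,
         λ z _ z≢ → sym (update-other ν₁ x (μ₂ (ρ x)) z≢)) ,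
        λ { _ refl → update-same ν₁ x (μ₂ (ρ x)) }
    }

  correct-asgc : ∀ x c σ ρ r → Correct (asgc {S = S} x c) σ ρ r
  correct-asgc x c σ ρ r = record
    { ioDisjoint = λ { z (() , _) }
    ; In⊆ = λ z ()
    ; In⊇ = λ _ ()
    ; Out⊆ = λ { z refl → inj₁ (x , refl , refl) }
    ; Out-ρ = λ { _ refl → refl }
    ; Out-temps = λ z ()
    ; temps-fresh = λ z ()
    ; simulates = λ 𝕍 D _ _ ν₁ ν₂ μ₁ in≡ (e , _) →
        update μ₁ (ρ x) c ,
        (update-same μ₁ (ρ x) c , λ z _ z≢ → sym (update-other μ₁ (ρ x) c z≢)) ,
        λ { _ refl → trans e (sym (update-same μ₁ (ρ x) c)) }
    ; reflects = λ 𝕍 D _ _ ν₁ μ₁ μ₂ in≡ (e , _) →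
        update ν₁ x (μ₂ (ρ x)) ,
        (trans (update-same ν₁ x (μ₂ (ρ x))) e , λ z _ z≢ → sym (update-other ν₁ x (μ₂ (ρ x)) z≢)) ,
        λ { _ refl → update-same ν₁ x (μ₂ (ρ x)) }
    }

-- Composition

module Composition {S : Schema} (a b : Expr S) (σ ρ : Var → Var) (r : ℕ → Var)
  (correct-a : ∀ σ ρ r → Separated a σ ρ r → Correct a σ ρ r)
  (correct-b : ∀ σ ρ r → Separated b σ ρ r → Correct b σ ρ r)
  (sep : Separated (a ⨾ b) σ ρ r) where

  open Separated sep

  t : ℕ → Var
  t = odds (odds r)
  ρ₁ σ₂ : Var → Var
  ρ₁ = redirect b t ρ
  σ₂ = readFrom a ρ₁ σ

  ρ₁-overwritten : ∀ x → Out b x → ρ₁ x ≡ t x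
  ρ₁-overwritten x o rewrite dec-true (Out? b x) o = refl
  ρ₁-kept : ∀ x → ¬ Out b x → ρ₁ x ≡ ρ x
  ρ₁-kept x ¬o rewrite dec-false (Out? b x) ¬o = refl
  σ₂-input : ∀ y → ¬ Out a y → σ₂ y ≡ σ y
  σ₂-input y ¬o rewrite dec-false (Out? a y) ¬o = refl

  r₁≢t : ∀ j k → evens r j ≢ t k
  r₁≢t j k = evens≢odds r-injective j (suc (2 * k))
  r₂≢t : ∀ j k → evens (odds r) j ≢ t k
  r₂≢t = evens≢odds (odds-injective r-injective)

  ρ₁≢r₁ : ∀ x k → Out a x → ρ₁ x ≢ evens r k
  ρ₁≢r₁ x k o with Out? b x
  ... | yes _ = λ e → r₁≢t k x (sym e)
  ... | no _ = ρ≢r x (2 * k) (inj₁ o)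

  ρ₁-injective : ∀ x y → Out a x → Out a y → ρ₁ x ≡ ρ₁ y → x ≡ y
  ρ₁-injective x y ox oy e with Out? b x | Out? b y
  ... | yes _ | yes _ = odds-injective (odds-injective r-injective) e
  ... | yes _ | no _ = ⊥-elim (ρ≢r y _ (inj₁ oy) (sym e))
  ... | no _ | yes _ = ⊥-elim (ρ≢r x _ (inj₁ ox) e)
  ... | no _ | no _ = ρ-injective x y (inj₁ ox) (inj₁ oy) e

  σ≢ρ₁ : ∀ y x → In a y → Out a x → σ y ≢ ρ₁ x
  σ≢ρ₁ y x i o with Out? b x
  ... | yes _ = σ≢r y _ (inj₁ i)
  ... | no _ = σ≢ρ y x (inj₁ i) (inj₁ o)

  sep-a : Separated a σ ρ₁ (evens r)
  sep-a = record
    { ρ-injective = ρ₁-injective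
    ; r-injective = evens-injective r-injective
    ; ρ≢r = ρ₁≢r₁
    ; σ≢ρ = σ≢ρ₁
    ; σ≢r = λ y k i → σ≢r y (2 * k) (inj₁ i)
    }

  σ₂≢ρ : ∀ y x → In b y → Out b x → σ₂ y ≢ ρ x
  σ₂≢ρ y x i o with Out? a y
  ... | no ¬oa = σ≢ρ y x (inj₂ (i , ¬oa)) (inj₂ o)
  ... | yes oa with Out? b y
  ...   | yes _ = λ e → ρ≢r x _ (inj₂ o) (sym e)
  ...   | no ¬ob = λ e → ¬ob (subst (Out b) (sym (ρ-injective y x (inj₁ oa) (inj₂ o) e)) o)

  σ₂≢r₂ : ∀ y k → In b y → σ₂ y ≢ evens (odds r) k
  σ₂≢r₂ y k i with Out? a y
  ... | no ¬oa = σ≢r y _ (inj₂ (i , ¬oa))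
  ... | yes oa with Out? b y
  ...   | yes _ = λ e → r₂≢t k y (sym e)
  ...   | no _ = ρ≢r y _ (inj₁ oa)

  sep-b : Separated b σ₂ ρ (evens (odds r))
  sep-b = record
    { ρ-injective = λ x y ox oy → ρ-injective x y (inj₂ ox) (inj₂ oy)
    ; r-injective = evens-injective (odds-injective r-injective)
    ; ρ≢r = λ x k o → ρ≢r x _ (inj₂ o)
    ; σ≢ρ = σ₂≢ρ
    ; σ≢r = σ₂≢r₂
    }

  module A = Correct (correct-a σ ρ₁ (evens r) sep-a)
  module B = Correct (correct-b σ₂ ρ (evens (odds r)) sep-b)

  β₁ β₂ : Expr S
  β₁ = expr a σ ρ₁ (evens r)
  β₂ = expr b σ₂ ρ (evens (odds r))
  t₁ t₂ t₃ : List Var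
  t₁ = temps a σ ρ₁ (evens r)
  t₂ = temps b σ₂ ρ (evens (odds r))
  t₃ = L.map t (filter (Out? b) (outputs a))

  σ∉Out-β₁ : ∀ y → In (a ⨾ b) y → ¬ Out β₁ (σ y)
  σ∉Out-β₁ y i o with A.Out⊆ _ o
  ... | inj₂ z∈ with A.temps-fresh _ z∈
  ...   | k , e = σ≢r y _ i e
  σ∉Out-β₁ y i o | inj₁ (x , ox , e) with Out? b x
  ...   | yes _ = σ≢r y _ i e
  ...   | no _ = σ≢ρ y x i (inj₁ ox) e

  ρ∉Out-β₂ : ∀ x → Out a x → ¬ Out b x → ¬ Out β₂ (ρ x)
  ρ∉Out-β₂ x oa ¬ob o with B.Out⊆ _ o
  ... | inj₁ (x′ , ob , e) = ¬ob (subst (Out b) (sym (ρ-injective x x′ (inj₁ oa) (inj₂ ob) e)) ob)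
  ... | inj₂ z∈ with B.temps-fresh _ z∈
  ...   | k , e = ρ≢r x _ (inj₁ oa) e

  ioDisjointHere-β : ioDisjointHere (β₁ ⨾ β₂)
  ioDisjointHere-β z (inj₁ i , inj₁ o) = IoDisjoint⇒ioDisjointHere β₁ A.ioDisjoint z (i , o)
  ioDisjointHere-β z (inj₁ i , inj₂ o) with A.In⊆ z i
  ... | y , y∈ , refl with B.Out⊆ _ o
  ...   | inj₁ (x , ox , e) = σ≢ρ y x (inj₁ y∈) (inj₂ ox) e
  ...   | inj₂ z∈ with B.temps-fresh _ z∈
  ...     | k , e = σ≢r y _ (inj₁ y∈) e
  ioDisjointHere-β z (inj₂ (i , ¬o) , inj₁ o) = ¬o o
  ioDisjointHere-β z (inj₂ (i , _) , inj₂ o) = IoDisjoint⇒ioDisjointHere β₂ B.ioDisjoint z (i , o)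

  In⊆ : ∀ z → In (β₁ ⨾ β₂) z → ∃ λ y → In (a ⨾ b) y × z ≡ σ y
  In⊆ z (inj₁ i) with A.In⊆ z i
  ... | y , y∈ , e = y , inj₁ y∈ , e
  In⊆ z (inj₂ (i , ¬o)) with B.In⊆ z i
  ... | y , y∈ , refl with Out? a y
  ...   | yes oa = ⊥-elim (¬o (A.Out-ρ y oa))
  ...   | no ¬oa = y , inj₂ (y∈ , ¬oa) , refl

  In⊇ : ∀ y → In (a ⨾ b) y → In (β₁ ⨾ β₂) (σ y)
  In⊇ y (inj₁ i) = inj₁ (A.In⊇ y i)
  In⊇ y (inj₂ (i , ¬oa)) = inj₂ (subst (In β₂) (σ₂-input y ¬oa) (B.In⊇ y i) , σ∉Out-β₁ y (inj₂ (i , ¬oa)))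

  ∈-temps⁺ : ∀ {z} → z ∈ₗ t₁ ⊎ z ∈ₗ t₂ ⊎ z ∈ₗ t₃ → z ∈ₗ t₁ ++ t₂ ++ t₃
  ∈-temps⁺ (inj₁ z∈) = ∈-++⁺ˡ z∈
  ∈-temps⁺ (inj₂ (inj₁ z∈)) = ∈-++⁺ʳ t₁ (∈-++⁺ˡ z∈)
  ∈-temps⁺ (inj₂ (inj₂ z∈)) = ∈-++⁺ʳ t₁ (∈-++⁺ʳ t₂ z∈)

  ∈-temps⁻ : ∀ {z} → z ∈ₗ t₁ ++ t₂ ++ t₃ → z ∈ₗ t₁ ⊎ z ∈ₗ t₂ ⊎ z ∈ₗ t₃
  ∈-temps⁻ z∈ = Sum.map₂ (∈-++⁻ t₂) (∈-++⁻ t₁ z∈)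

  Out⊆ : ∀ z → Out (β₁ ⨾ β₂) z → (∃ λ x → Out (a ⨾ b) x × z ≡ ρ x) ⊎ z ∈ₗ t₁ ++ t₂ ++ t₃
  Out⊆ z (inj₁ o) with A.Out⊆ z o
  ... | inj₂ z∈ = inj₂ (∈-temps⁺ (inj₁ z∈))
  ... | inj₁ (x , ox , refl) with Out? b x
  ...   | yes ob = inj₂ (∈-temps⁺ (inj₂ (inj₂ (∈-map⁺ t (∈-filter⁺ (Out? b) (∈-outputs⁺ a ox) ob)))))
  ...   | no _ = inj₁ (x , inj₁ ox , refl)
  Out⊆ z (inj₂ o) with B.Out⊆ z o
  ... | inj₂ z∈ = inj₂ (∈-temps⁺ (inj₂ (inj₁ z∈)))
  ... | inj₁ (x , ox , e) = inj₁ (x , inj₂ ox , e)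

  Out-ρ : ∀ x → Out (a ⨾ b) x → Out (β₁ ⨾ β₂) (ρ x)
  Out-ρ x (inj₂ ob) = inj₂ (B.Out-ρ x ob)
  Out-ρ x (inj₁ oa) with Out? b x
  ... | yes ob = inj₂ (B.Out-ρ x ob)
  ... | no ¬ob = inj₁ (subst (Out β₁) (ρ₁-kept x ¬ob) (A.Out-ρ x oa))

  Out-temps : ∀ z → z ∈ₗ t₁ ++ t₂ ++ t₃ → Out (β₁ ⨾ β₂) z
  Out-temps z z∈ with ∈-temps⁻ z∈
  ... | inj₁ z∈₁ = inj₁ (A.Out-temps z z∈₁)
  ... | inj₂ (inj₁ z∈₂) = inj₂ (B.Out-temps z z∈₂)
  ... | inj₂ (inj₂ z∈₃) with ∈-map⁻ t z∈₃
  ...   | x , x∈ , refl with ∈-filter⁻ (Out? b) x∈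
  ...     | x∈a , ob = inj₁ (subst (Out β₁) (ρ₁-overwritten x ob) (A.Out-ρ x (∈-outputs⁻ a x∈a)))

  temps-fresh : ∀ z → z ∈ₗ t₁ ++ t₂ ++ t₃ → ∃ λ k → z ≡ r k
  temps-fresh z z∈ with ∈-temps⁻ z∈
  ... | inj₁ z∈₁ with A.temps-fresh z z∈₁
  ...   | k , e = 2 * k , e
  temps-fresh z z∈ | inj₂ (inj₁ z∈₂) with B.temps-fresh z z∈₂
  ...   | k , e = suc (2 * (2 * k)) , e
  temps-fresh z z∈ | inj₂ (inj₂ z∈₃) with ∈-map⁻ t z∈₃
  ...   | x , _ , e = suc (2 * suc (2 * x)) , e

  module _ (𝕍 : Var → Set) (D : Instance S) (α⊆𝕍 : ∀ z → vars (a ⨾ b) z → 𝕍 z)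
           (β⊆𝕍 : ∀ z → vars (β₁ ⨾ β₂) z → 𝕍 z) where
    open Semantics {S = S} 𝕍 D

    a⊆𝕍 : ∀ z → vars a z → 𝕍 z
    a⊆𝕍 z v = α⊆𝕍 z (inj₁ v)
    b⊆𝕍 : ∀ z → vars b z → 𝕍 z
    b⊆𝕍 z v = α⊆𝕍 z (inj₂ v)
    β₁⊆𝕍 : ∀ z → vars β₁ z → 𝕍 z
    β₁⊆𝕍 z v = β⊆𝕍 z (inj₁ v)
    β₂⊆𝕍 : ∀ z → vars β₂ z → 𝕍 z
    β₂⊆𝕍 z v = β⊆𝕍 z (inj₂ v)

    -- An input of b is read either from where β₁ put a's result, or from its untouched input copy.
    intermediate-in≡ : ∀ {ν₁ μ₁ ν μ} → (∀ y → In (a ⨾ b) y → μ₁ (σ y) ≡ ν₁ y)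
      → ⟦ a ⟧ 𝕍 D ν₁ ν → ⟦ β₁ ⟧ 𝕍 D μ₁ μ → (∀ x → Out a x → ν x ≡ μ (ρ₁ x))
      → ∀ y → In b y → μ (σ₂ y) ≡ ν y
    intermediate-in≡ in≡ ⟦a⟧ ⟦β₁⟧ out≡ y i with Out? a y
    ... | yes oa = sym (out≡ y oa)
    ... | no ¬oa = trans (sym (⟦⟧-frame β₁ ⟦β₁⟧ (σ y) (β⊆𝕍 _ (In⊆vars (β₁ ⨾ β₂) (In⊇ y iy))) (σ∉Out-β₁ y iy)))
                     (trans (in≡ y iy) (⟦⟧-frame a ⟦a⟧ y (α⊆𝕍 y (In⊆vars (a ⨾ b) iy)) ¬oa))
      where iy = inj₂ (i , ¬oa)

    final-out≡ : ∀ {ν ν₂ μ μ₂} → ⟦ b ⟧ 𝕍 D ν ν₂ → ⟦ β₂ ⟧ 𝕍 D μ μ₂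
      → (∀ x → Out a x → ν x ≡ μ (ρ₁ x)) → (∀ x → Out b x → ν₂ x ≡ μ₂ (ρ x))
      → ∀ x → Out (a ⨾ b) x → ν₂ x ≡ μ₂ (ρ x)
    final-out≡ {μ = μ} ⟦b⟧ ⟦β₂⟧ out≡₁ out≡₂ x o with Out? b x
    ... | yes ob = out≡₂ x ob
    ... | no ¬ob with o
    ...   | inj₂ ob = ⊥-elim (¬ob ob)
    ...   | inj₁ oa = trans (sym (⟦⟧-frame b ⟦b⟧ x (α⊆𝕍 x (Out⊆vars (a ⨾ b) o)) ¬ob))
                        (trans (out≡₁ x oa) (trans (cong μ (ρ₁-kept x ¬ob))
                        (⟦⟧-frame β₂ ⟦β₂⟧ (ρ x) (β⊆𝕍 _ (Out⊆vars (β₁ ⨾ β₂) (Out-ρ x o))) (ρ∉Out-β₂ x oa ¬ob))))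

    simulates : ∀ ν₁ ν₂ μ₁ → (∀ y → In (a ⨾ b) y → μ₁ (σ y) ≡ ν₁ y) → ⟦ a ⨾ b ⟧ 𝕍 D ν₁ ν₂
      → ∃ λ μ₂ → ⟦ β₁ ⨾ β₂ ⟧ 𝕍 D μ₁ μ₂ × (∀ x → Out (a ⨾ b) x → ν₂ x ≡ μ₂ (ρ x))
    simulates ν₁ ν₂ μ₁ in≡ (ν , ⟦a⟧ , ⟦b⟧)
      with A.simulates 𝕍 D a⊆𝕍 β₁⊆𝕍 ν₁ ν μ₁ (λ y i → in≡ y (inj₁ i)) ⟦a⟧
    ... | μ , ⟦β₁⟧ , out≡₁ with B.simulates 𝕍 D b⊆𝕍 β₂⊆𝕍 ν ν₂ μ (intermediate-in≡ in≡ ⟦a⟧ ⟦β₁⟧ out≡₁) ⟦b⟧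
    ...   | μ₂ , ⟦β₂⟧ , out≡₂ = μ₂ , (μ , ⟦β₁⟧ , ⟦β₂⟧) , final-out≡ ⟦b⟧ ⟦β₂⟧ out≡₁ out≡₂

    reflects : ∀ ν₁ μ₁ μ₂ → (∀ y → In (a ⨾ b) y → μ₁ (σ y) ≡ ν₁ y) → ⟦ β₁ ⨾ β₂ ⟧ 𝕍 D μ₁ μ₂
      → ∃ λ ν₂ → ⟦ a ⨾ b ⟧ 𝕍 D ν₁ ν₂ × (∀ x → Out (a ⨾ b) x → ν₂ x ≡ μ₂ (ρ x))
    reflects ν₁ μ₁ μ₂ in≡ (μ , ⟦β₁⟧ , ⟦β₂⟧)
      with A.reflects 𝕍 D a⊆𝕍 β₁⊆𝕍 ν₁ μ₁ μ (λ y i → in≡ y (inj₁ i)) ⟦β₁⟧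
    ... | ν , ⟦a⟧ , out≡₁ with B.reflects 𝕍 D b⊆𝕍 β₂⊆𝕍 ν μ μ₂ (intermediate-in≡ in≡ ⟦a⟧ ⟦β₁⟧ out≡₁) ⟦β₂⟧
    ...   | ν₂ , ⟦b⟧ , out≡₂ = ν₂ , (ν , ⟦a⟧ , ⟦b⟧) , final-out≡ ⟦b⟧ ⟦β₂⟧ out≡₁ out≡₂

  correct : Correct (a ⨾ b) σ ρ r
  correct = record
    { ioDisjoint = ioDisjointHere-β , A.ioDisjoint , B.ioDisjoint
    ; In⊆ = In⊆
    ; In⊇ = In⊇
    ; Out⊆ = Out⊆
    ; Out-ρ = Out-ρ
    ; Out-temps = Out-temps
    ; temps-fresh = temps-fresh
    ; simulates = simulates
    ; reflects = reflects
    }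

-- Union

module PaddedBranch {S : Schema} (a b : Expr S) (σ ρ : Var → Var) (r rₐ : ℕ → Var) (t₂ : List Var)
  (Input : Var → Set)
  (correct-a : Correct a σ ρ rₐ)
  (rₐ⊆r : ∀ k → ∃ λ j → rₐ k ≡ r j)
  (t₂-fresh : ∀ z → z ∈ₗ t₂ → ∃ λ k → z ≡ r k)
  (In-a⊆ : ∀ y → In a y → Input y)
  (onlyOut-b⊆ : ∀ y → Out b y → ¬ Out a y → Input y)
  (σ≢ρ : ∀ y x → Input y → Out a x ⊎ Out b x → σ y ≢ ρ x)
  (σ≢r : ∀ y k → Input y → σ y ≢ r k)
  (ρ-injective : ∀ x y → Out a x ⊎ Out b x → Out a y ⊎ Out b y → ρ x ≡ ρ y → x ≡ y)
  (ρ≢r : ∀ x k → Out a x ⊎ Out b x → ρ x ≢ r k) where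

  module A = Correct correct-a

  β₁ : Expr S
  β₁ = expr a σ ρ rₐ
  t₁ L₁ : List Var
  t₁ = temps a σ ρ rₐ
  L₁ = outputsOnly b a
  assignments₁ resets₂ : List (Expr S)
  assignments₁ = assignments ρ σ L₁
  resets₂ = resets t₂
  copied padded : Expr S
  copied = seqAll β₁ assignments₁
  padded = padBranch a b σ ρ β₁ t₂

  ∈-L₁⁻ : ∀ {x} → x ∈ₗ L₁ → Out b x × ¬ Out a x
  ∈-L₁⁻ x∈ with ∈-filter⁻ (λ x → ¬? (Out? a x)) x∈
  ... | x∈b , ¬oa = ∈-outputs⁻ b x∈b , ¬oa

  ∈-L₁⁺ : ∀ {x} → Out b x → ¬ Out a x → x ∈ₗ L₁
  ∈-L₁⁺ ob ¬oa = ∈-filter⁺ (λ x → ¬? (Out? a x)) (∈-outputs⁺ b ob) ¬oa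

  L₁⊆Input : ∀ {x} → x ∈ₗ L₁ → Input x
  L₁⊆Input x∈ = onlyOut-b⊆ _ (proj₁ (∈-L₁⁻ x∈)) (proj₂ (∈-L₁⁻ x∈))

  t₁-fresh : ∀ z → z ∈ₗ t₁ → ∃ λ k → z ≡ r k
  t₁-fresh z z∈ with A.temps-fresh z z∈
  ... | k , refl = rₐ⊆r k

  σ∉Out-β₁ : ∀ y → Input y → ¬ Out β₁ (σ y)
  σ∉Out-β₁ y i o with A.Out⊆ _ o
  ... | inj₁ (x , ox , e) = σ≢ρ y x i (inj₁ ox) e
  ... | inj₂ z∈ with t₁-fresh _ z∈
  ...   | k , e = σ≢r y k i e

  ioAssignments : ∀ z → InAny assignments₁ z → ¬ OutAny assignments₁ z
  ioAssignments z i o with ∈-map⁻ σ (In-assignments⁻ ρ σ L₁ i) | ∈-map⁻ ρ (Out-assignments⁻ ρ σ L₁ o)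
  ... | x , x∈ , refl | x′ , x′∈ , e = σ≢ρ x x′ (L₁⊆Input x∈) (inj₂ (proj₁ (∈-L₁⁻ x′∈))) e

  ioResets : ∀ z → InAny resets₂ z → ¬ OutAny resets₂ z
  ioResets z i _ = ¬In-resets t₂ i

  In-copied⊆ : ∀ z → In copied z → ∃ λ y → Input y × z ≡ σ y
  In-copied⊆ z i with In-seqAll⁻ β₁ assignments₁ i
  ... | inj₁ i₁ with A.In⊆ z i₁
  ...   | y , y∈ , e = y , In-a⊆ y y∈ , e
  In-copied⊆ z i | inj₂ (i₂ , _) with ∈-map⁻ σ (In-assignments⁻ ρ σ L₁ i₂)
  ...   | x , x∈ , e = x , L₁⊆Input x∈ , e

  In-padded⊆ : ∀ z → In padded z → ∃ λ y → Input y × z ≡ σ y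
  In-padded⊆ z i with In-seqAll⁻ copied resets₂ i
  ... | inj₁ i₁ = In-copied⊆ z i₁
  ... | inj₂ (i₂ , _) = ⊥-elim (¬In-resets t₂ i₂)

  ioDisjoint-copied : IoDisjoint copied
  ioDisjoint-copied =
    IoDisjoint-seqAll β₁ assignments₁ A.ioDisjoint
      (IoDisjoint-assignments ρ σ L₁ (λ x x∈ → σ≢ρ x x (L₁⊆Input x∈) (inj₂ (proj₁ (∈-L₁⁻ x∈)))))
      ioAssignments β₁↛assignments
    where
    β₁↛assignments : ∀ z → In β₁ z → ¬ OutAny assignments₁ z
    β₁↛assignments z i o with A.In⊆ z i | ∈-map⁻ ρ (Out-assignments⁻ ρ σ L₁ o)
    ... | y , y∈ , refl | x′ , x′∈ , e = σ≢ρ y x′ (In-a⊆ y y∈) (inj₂ (proj₁ (∈-L₁⁻ x′∈))) e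

  ioDisjoint : IoDisjoint padded
  ioDisjoint = IoDisjoint-seqAll copied resets₂ ioDisjoint-copied (IoDisjoint-resets t₂) ioResets copied↛resets
    where
    copied↛resets : ∀ z → In copied z → ¬ OutAny resets₂ z
    copied↛resets z i o with In-copied⊆ z i | t₂-fresh z (Out-resets⁻ t₂ o)
    ... | y , y∈ , refl | k , e = σ≢r y k y∈ e

  In⊇-a : ∀ y → In a y → In padded (σ y)
  In⊇-a y i = In-seqAll⁺ copied resets₂ ioResets (inj₁ (In-seqAll⁺ β₁ assignments₁ ioAssignments (inj₁ (A.In⊇ y i))))

  In⊇-onlyOut-b : ∀ y → Out b y → ¬ Out a y → In padded (σ y)
  In⊇-onlyOut-b y ob ¬oa =
    In-seqAll⁺ copied resets₂ ioResets (inj₁ (In-seqAll⁺ β₁ assignments₁ ioAssignments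
      (inj₂ (In-assignments⁺ ρ σ L₁ (∈-map⁺ σ (∈-L₁⁺ ob ¬oa)) , σ∉Out-β₁ y (onlyOut-b⊆ y ob ¬oa)))))

  Out⊆ : ∀ z → Out padded z → (∃ λ x → (Out a x ⊎ Out b x) × z ≡ ρ x) ⊎ (z ∈ₗ t₁ ⊎ z ∈ₗ t₂)
  Out⊆ z o with Out-seqAll⁻ copied resets₂ o
  ... | inj₂ o₂ = inj₂ (inj₂ (Out-resets⁻ t₂ o₂))
  ... | inj₁ o₁ with Out-seqAll⁻ β₁ assignments₁ o₁
  ...   | inj₂ o₁₂ with ∈-map⁻ ρ (Out-assignments⁻ ρ σ L₁ o₁₂)
  ...     | x , x∈ , e = inj₁ (x , inj₂ (proj₁ (∈-L₁⁻ x∈)) , e)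
  Out⊆ z o | inj₁ o₁ | inj₁ o₁₁ with A.Out⊆ z o₁₁
  ...     | inj₁ (x , ox , e) = inj₁ (x , inj₁ ox , e)
  ...     | inj₂ z∈ = inj₂ (inj₁ z∈)

  Out-ρ : ∀ x → Out a x ⊎ Out b x → Out padded (ρ x)
  Out-ρ x (inj₁ oa) = Out-seqAll⁺ copied resets₂ (inj₁ (Out-seqAll⁺ β₁ assignments₁ (inj₁ (A.Out-ρ x oa))))
  Out-ρ x (inj₂ ob) with Out? a x
  ... | yes oa = Out-ρ x (inj₁ oa)
  ... | no ¬oa = Out-seqAll⁺ copied resets₂ (inj₁ (Out-seqAll⁺ β₁ assignments₁
                   (inj₂ (Out-assignments⁺ ρ σ L₁ (∈-map⁺ ρ (∈-L₁⁺ ob ¬oa))))))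

  Out-t₁ : ∀ z → z ∈ₗ t₁ → Out padded z
  Out-t₁ z z∈ = Out-seqAll⁺ copied resets₂ (inj₁ (Out-seqAll⁺ β₁ assignments₁ (inj₁ (A.Out-temps z z∈))))

  Out-t₂ : ∀ z → z ∈ₗ t₂ → Out padded z
  Out-t₂ z z∈ = Out-seqAll⁺ copied resets₂ (inj₂ (Out-resets⁺ t₂ z∈))

  module _ (𝕍 : Var → Set) (D : Instance S) (a⊆𝕍 : ∀ z → vars a z → 𝕍 z)
           (padded⊆𝕍 : ∀ z → vars padded z → 𝕍 z) (Out-b⊆𝕍 : ∀ x → Out b x → 𝕍 x) where
    open Semantics {S = S} 𝕍 D
    open RunSemantics {S = S} 𝕍 D
    open BlockRuns {S = S} 𝕍 D

    copied⊆𝕍 : ∀ z → vars copied z → 𝕍 z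
    copied⊆𝕍 z v = padded⊆𝕍 z (vars-seqAll⁺ copied resets₂ (inj₁ v))
    β₁⊆𝕍 : ∀ z → vars β₁ z → 𝕍 z
    β₁⊆𝕍 z v = copied⊆𝕍 z (vars-seqAll⁺ β₁ assignments₁ (inj₁ v))
    t₂⊆𝕍 : ∀ z → z ∈ₗ t₂ → 𝕍 z
    t₂⊆𝕍 z z∈ = padded⊆𝕍 z (vars-seqAll⁺ copied resets₂ (inj₂ (vars-resets t₂ z∈)))
    ρ∈𝕍 : ∀ x → Out a x ⊎ Out b x → 𝕍 (ρ x)
    ρ∈𝕍 x o = padded⊆𝕍 _ (Out⊆vars padded (Out-ρ x o))

    copyable : Copyable ρ σ L₁
    copyable = record
      { target∈𝕍 = λ x x∈ →
          copied⊆𝕍 _ (vars-seqAll⁺ β₁ assignments₁ (inj₂ (vars-assignments-target ρ σ L₁ (∈-map⁺ ρ x∈))))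
      ; source∈𝕍 = λ x x∈ →
          copied⊆𝕍 _ (vars-seqAll⁺ β₁ assignments₁ (inj₂ (vars-assignments-source ρ σ L₁ (∈-map⁺ σ x∈))))
      ; target-injective = λ x y x∈ y∈ → ρ-injective x y (inj₂ (proj₁ (∈-L₁⁻ x∈))) (inj₂ (proj₁ (∈-L₁⁻ y∈)))
      ; source≢target = λ x y x∈ y∈ → σ≢ρ x y (L₁⊆Input x∈) (inj₂ (proj₁ (∈-L₁⁻ y∈)))
      }

    ρ∉map-ρ-L₁ : ∀ x → Out a x → ¬ ρ x ∈ₗ L.map ρ L₁
    ρ∉map-ρ-L₁ x oa ρx∈ with ∈-map⁻ ρ ρx∈
    ... | x′ , x′∈ , e = proj₂ (∈-L₁⁻ x′∈) (subst (Out a) (ρ-injective x x′ (inj₁ oa) (inj₂ (proj₁ (∈-L₁⁻ x′∈))) e) oa)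

    padded-out≡ : ∀ {ν₁ ν₂ μ₁ μ μ′ μ₂ : Val} → (∀ y → Input y → μ₁ (σ y) ≡ ν₁ y)
      → ⟦ a ⟧ 𝕍 D ν₁ ν₂ → ⟦ β₁ ⟧ 𝕍 D μ₁ μ → (∀ x → Out a x → ν₂ x ≡ μ (ρ x))
      → CopiedFrom ρ σ L₁ μ μ′ → (∀ z → 𝕍 z → ¬ z ∈ₗ t₂ → μ′ z ≡ μ₂ z)
      → ∀ x → Out a x ⊎ Out b x → ν₂ x ≡ μ₂ (ρ x)
    padded-out≡ {ν₁} {ν₂} {μ₁} {μ} {μ′} in≡ ⟦a⟧ ⟦β₁⟧ out≡ (copies , rest) untouched x o =
      trans (out≡′ o) (untouched (ρ x) (ρ∈𝕍 x o) (λ ρx∈ → ρx∉t₂ (t₂-fresh _ ρx∈)))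
      where
      ρx∉t₂ : ¬ ∃ λ k → ρ x ≡ r k
      ρx∉t₂ (k , e) = ρ≢r x k o e
      out≡′ : Out a x ⊎ Out b x → ν₂ x ≡ μ′ (ρ x)
      out≡′ _ with Out? a x
      out≡′ _ | yes oa = trans (out≡ x oa) (rest (ρ x) (ρ∈𝕍 x o) (ρ∉map-ρ-L₁ x oa))
      out≡′ (inj₁ oa) | no ¬oa = ⊥-elim (¬oa oa)
      out≡′ (inj₂ ob) | no ¬oa =
        sym (trans (copies x (∈-L₁⁺ ob ¬oa))
              (trans (sym (⟦⟧-frame β₁ ⟦β₁⟧ (σ x) (padded⊆𝕍 _ (In⊆vars padded (In⊇-onlyOut-b x ob ¬oa)))
                                                 (σ∉Out-β₁ x (onlyOut-b⊆ x ob ¬oa))))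
              (trans (in≡ x (onlyOut-b⊆ x ob ¬oa)) (⟦⟧-frame a ⟦a⟧ x (Out-b⊆𝕍 x ob) ¬oa))))

    simulates : ∀ (ν₁ ν₂ μ₁ : Val) → (∀ y → Input y → μ₁ (σ y) ≡ ν₁ y) → ⟦ a ⟧ 𝕍 D ν₁ ν₂
      → ∃ λ μ₂ → ⟦ padded ⟧ 𝕍 D μ₁ μ₂ × (∀ x → Out a x ⊎ Out b x → ν₂ x ≡ μ₂ (ρ x))
    simulates ν₁ ν₂ μ₁ in≡ ⟦a⟧ with A.simulates 𝕍 D a⊆𝕍 β₁⊆𝕍 ν₁ ν₂ μ₁ (λ y i → in≡ y (In-a⊆ y i)) ⟦a⟧
    ... | μ , ⟦β₁⟧ , out≡ with run-assignments⁺ ρ σ L₁ μ copyable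
    ...   | μ′ , runC , copiedFrom with run-resets⁺ t₂ μ′ t₂⊆𝕍
    ...     | μ₂ , runZ , (_ , untouched) =
      μ₂ , ⟦seqAll⟧⁺ copied resets₂ padded⊆𝕍 (⟦seqAll⟧⁺ β₁ assignments₁ copied⊆𝕍 ⟦β₁⟧ runC) runZ ,
      padded-out≡ in≡ ⟦a⟧ ⟦β₁⟧ out≡ copiedFrom untouched

    reflects : ∀ (ν₁ μ₁ μ₂ : Val) → (∀ y → Input y → μ₁ (σ y) ≡ ν₁ y) → ⟦ padded ⟧ 𝕍 D μ₁ μ₂
      → ∃ λ ν₂ → ⟦ a ⟧ 𝕍 D ν₁ ν₂ × (∀ x → Out a x ⊎ Out b x → ν₂ x ≡ μ₂ (ρ x))
    reflects ν₁ μ₁ μ₂ in≡ ⟦padded⟧ with ⟦seqAll⟧⁻ copied resets₂ ⟦padded⟧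
    ... | μ′ , ⟦copied⟧ , runZ with ⟦seqAll⟧⁻ β₁ assignments₁ ⟦copied⟧
    ...   | μ , ⟦β₁⟧ , runC with A.reflects 𝕍 D a⊆𝕍 β₁⊆𝕍 ν₁ μ₁ μ (λ y i → in≡ y (In-a⊆ y i)) ⟦β₁⟧
    ...     | ν₂ , ⟦a⟧ , out≡ =
      ν₂ , ⟦a⟧ ,
      padded-out≡ in≡ ⟦a⟧ ⟦β₁⟧ out≡ (run-assignments⁻ ρ σ L₁ copyable runC) (proj₂ (run-resets⁻ t₂ t₂⊆𝕍 runZ))

module Union {S : Schema} (a b : Expr S) (σ ρ : Var → Var) (r : ℕ → Var)
  (correct-a : ∀ σ ρ r → Separated a σ ρ r → Correct a σ ρ r)
  (correct-b : ∀ σ ρ r → Separated b σ ρ r → Correct b σ ρ r)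
  (sep : Separated (a ∪ₑ b) σ ρ r) where

  open Separated sep

  sep-a : Separated a σ ρ (evens r)
  sep-a = record
    { ρ-injective = λ x y ox oy → ρ-injective x y (inj₁ ox) (inj₁ oy)
    ; r-injective = evens-injective r-injective
    ; ρ≢r = λ x k o → ρ≢r x _ (inj₁ o)
    ; σ≢ρ = λ y x i o → σ≢ρ y x (inj₁ i) (inj₁ o)
    ; σ≢r = λ y k i → σ≢r y _ (inj₁ i)
    }

  sep-b : Separated b σ ρ (odds r)
  sep-b = record
    { ρ-injective = λ x y ox oy → ρ-injective x y (inj₂ ox) (inj₂ oy)
    ; r-injective = odds-injective r-injective
    ; ρ≢r = λ x k o → ρ≢r x _ (inj₂ o)
    ; σ≢ρ = λ y x i o → σ≢ρ y x (inj₂ (inj₁ i)) (inj₂ o)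
    ; σ≢r = λ y k i → σ≢r y _ (inj₂ (inj₁ i))
    }

  module A = Correct (correct-a σ ρ (evens r) sep-a)
  module B = Correct (correct-b σ ρ (odds r) sep-b)

  t₁ t₂ : List Var
  t₁ = temps a σ ρ (evens r)
  t₂ = temps b σ ρ (odds r)

  module X₁ = PaddedBranch a b σ ρ r (evens r) t₂ (In (a ∪ₑ b)) (correct-a σ ρ (evens r) sep-a) (λ k → 2 * k , refl)
    (λ z z∈ → suc (2 * proj₁ (B.temps-fresh z z∈)) , proj₂ (B.temps-fresh z z∈))
    (λ y i → inj₁ i) (λ y ob ¬oa → inj₂ (inj₂ (inj₂ (ob , ¬oa))))
    σ≢ρ σ≢r ρ-injective ρ≢r
  module X₂ = PaddedBranch b a σ ρ r (odds r) t₁ (In (a ∪ₑ b)) (correct-b σ ρ (odds r) sep-b)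
    (λ k → suc (2 * k) , refl)
    (λ z z∈ → 2 * proj₁ (A.temps-fresh z z∈) , proj₂ (A.temps-fresh z z∈))
    (λ y i → inj₂ (inj₁ i)) (λ y oa ¬ob → inj₂ (inj₂ (inj₁ (oa , ¬ob))))
    (λ y x i o → σ≢ρ y x i (swap o)) σ≢r
    (λ x y ox oy → ρ-injective x y (swap ox) (swap oy)) (λ x k o → ρ≢r x k (swap o))

  Out-X₁⊆X₂ : ∀ z → Out X₁.padded z → Out X₂.padded z
  Out-X₁⊆X₂ z o with X₁.Out⊆ z o
  ... | inj₁ (x , ox , refl) = X₂.Out-ρ x (swap ox)
  ... | inj₂ (inj₁ z∈) = X₂.Out-t₂ z z∈
  ... | inj₂ (inj₂ z∈) = X₂.Out-t₁ z z∈

  Out-X₂⊆X₁ : ∀ z → Out X₂.padded z → Out X₁.padded z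
  Out-X₂⊆X₁ z o with X₂.Out⊆ z o
  ... | inj₁ (x , ox , refl) = X₁.Out-ρ x (swap ox)
  ... | inj₂ (inj₁ z∈) = X₁.Out-t₂ z z∈
  ... | inj₂ (inj₂ z∈) = X₁.Out-t₁ z z∈

  In↛Out-X₁ : ∀ z → In (X₁.padded ∪ₑ X₂.padded) z → ¬ Out X₁.padded z
  In↛Out-X₁ z (inj₁ i) o = IoDisjoint⇒ioDisjointHere X₁.padded X₁.ioDisjoint z (i , o)
  In↛Out-X₁ z (inj₂ (inj₁ i)) o with X₂.In-padded⊆ z i
  ... | y , y∈ , refl with X₁.Out⊆ _ o
  ...   | inj₁ (x , ox , e) = σ≢ρ y x y∈ ox e
  ...   | inj₂ (inj₁ z∈) = σ≢r y _ y∈ (proj₂ (A.temps-fresh _ z∈))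
  ...   | inj₂ (inj₂ z∈) = σ≢r y _ y∈ (proj₂ (B.temps-fresh _ z∈))
  In↛Out-X₁ z (inj₂ (inj₂ (inj₁ (o₁ , ¬o₂)))) o = ¬o₂ (Out-X₁⊆X₂ z o₁)
  In↛Out-X₁ z (inj₂ (inj₂ (inj₂ (o₂ , ¬o₁)))) o = ¬o₁ o

  ioDisjointHere-X : ioDisjointHere (X₁.padded ∪ₑ X₂.padded)
  ioDisjointHere-X z (i , inj₁ o) = In↛Out-X₁ z i o
  ioDisjointHere-X z (i , inj₂ o) = In↛Out-X₁ z i (Out-X₂⊆X₁ z o)

  In⊆ : ∀ z → In (X₁.padded ∪ₑ X₂.padded) z → ∃ λ y → In (a ∪ₑ b) y × z ≡ σ y
  In⊆ z (inj₁ i) = X₁.In-padded⊆ z i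
  In⊆ z (inj₂ (inj₁ i)) = X₂.In-padded⊆ z i
  In⊆ z (inj₂ (inj₂ (inj₁ (o₁ , ¬o₂)))) = ⊥-elim (¬o₂ (Out-X₁⊆X₂ z o₁))
  In⊆ z (inj₂ (inj₂ (inj₂ (o₂ , ¬o₁)))) = ⊥-elim (¬o₁ (Out-X₂⊆X₁ z o₂))

  In⊇ : ∀ y → In (a ∪ₑ b) y → In (X₁.padded ∪ₑ X₂.padded) (σ y)
  In⊇ y (inj₁ ia) = inj₁ (X₁.In⊇-a y ia)
  In⊇ y (inj₂ (inj₁ ib)) = inj₂ (inj₁ (X₂.In⊇-a y ib))
  In⊇ y (inj₂ (inj₂ (inj₁ (oa , ¬ob)))) = inj₂ (inj₁ (X₂.In⊇-onlyOut-b y oa ¬ob))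
  In⊇ y (inj₂ (inj₂ (inj₂ (ob , ¬oa)))) = inj₁ (X₁.In⊇-onlyOut-b y ob ¬oa)

  Out⊆ : ∀ z → Out (X₁.padded ∪ₑ X₂.padded) z → (∃ λ x → Out (a ∪ₑ b) x × z ≡ ρ x) ⊎ z ∈ₗ t₁ ++ t₂
  Out⊆ z o with X₁.Out⊆ z ([ (λ o → o) , Out-X₂⊆X₁ z ] o)
  ... | inj₁ w = inj₁ w
  ... | inj₂ (inj₁ z∈) = inj₂ (∈-++⁺ˡ z∈)
  ... | inj₂ (inj₂ z∈) = inj₂ (∈-++⁺ʳ t₁ z∈)

  Out-temps : ∀ z → z ∈ₗ t₁ ++ t₂ → Out (X₁.padded ∪ₑ X₂.padded) z
  Out-temps z z∈ = inj₁ ([ X₁.Out-t₁ z , X₁.Out-t₂ z ] (∈-++⁻ t₁ z∈))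

  temps-fresh : ∀ z → z ∈ₗ t₁ ++ t₂ → ∃ λ k → z ≡ r k
  temps-fresh z z∈ with ∈-++⁻ t₁ z∈
  ... | inj₁ z∈₁ with A.temps-fresh z z∈₁
  ...   | k , e = 2 * k , e
  temps-fresh z z∈ | inj₂ z∈₂ with B.temps-fresh z z∈₂
  ...   | k , e = suc (2 * k) , e

  simulates : Simulates (a ∪ₑ b) (X₁.padded ∪ₑ X₂.padded) σ ρ
  simulates 𝕍 D α⊆𝕍 β⊆𝕍 ν₁ ν₂ μ₁ in≡ (inj₁ ⟦a⟧)
    with X₁.simulates 𝕍 D (λ z v → α⊆𝕍 z (inj₁ v)) (λ z v → β⊆𝕍 z (inj₁ v))
           (λ x o → α⊆𝕍 x (inj₂ (Out⊆vars b o))) ν₁ ν₂ μ₁ in≡ ⟦a⟧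
  ... | μ₂ , ⟦X₁⟧ , out≡ = μ₂ , inj₁ ⟦X₁⟧ , out≡
  simulates 𝕍 D α⊆𝕍 β⊆𝕍 ν₁ ν₂ μ₁ in≡ (inj₂ ⟦b⟧)
    with X₂.simulates 𝕍 D (λ z v → α⊆𝕍 z (inj₂ v)) (λ z v → β⊆𝕍 z (inj₂ v))
           (λ x o → α⊆𝕍 x (inj₁ (Out⊆vars a o))) ν₁ ν₂ μ₁ in≡ ⟦b⟧
  ... | μ₂ , ⟦X₂⟧ , out≡ = μ₂ , inj₂ ⟦X₂⟧ , λ x o → out≡ x (swap o)

  reflects : Reflects (a ∪ₑ b) (X₁.padded ∪ₑ X₂.padded) σ ρ
  reflects 𝕍 D α⊆𝕍 β⊆𝕍 ν₁ μ₁ μ₂ in≡ (inj₁ ⟦X₁⟧)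
    with X₁.reflects 𝕍 D (λ z v → α⊆𝕍 z (inj₁ v)) (λ z v → β⊆𝕍 z (inj₁ v))
           (λ x o → α⊆𝕍 x (inj₂ (Out⊆vars b o))) ν₁ μ₁ μ₂ in≡ ⟦X₁⟧
  ... | ν₂ , ⟦a⟧ , out≡ = ν₂ , inj₁ ⟦a⟧ , out≡
  reflects 𝕍 D α⊆𝕍 β⊆𝕍 ν₁ μ₁ μ₂ in≡ (inj₂ ⟦X₂⟧)
    with X₂.reflects 𝕍 D (λ z v → α⊆𝕍 z (inj₂ v)) (λ z v → β⊆𝕍 z (inj₂ v))
           (λ x o → α⊆𝕍 x (inj₁ (Out⊆vars a o))) ν₁ μ₁ μ₂ in≡ ⟦X₂⟧
  ... | ν₂ , ⟦b⟧ , out≡ = ν₂ , inj₂ ⟦b⟧ , λ x o → out≡ x (swap o)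

  correct : Correct (a ∪ₑ b) σ ρ r
  correct = record
    { ioDisjoint = ioDisjointHere-X , X₁.ioDisjoint , X₂.ioDisjoint
    ; In⊆ = In⊆
    ; In⊇ = In⊇
    ; Out⊆ = Out⊆
    ; Out-ρ = λ x o → inj₁ (X₁.Out-ρ x o)
    ; Out-temps = Out-temps
    ; temps-fresh = temps-fresh
    ; simulates = simulates
    ; reflects = reflects
    }

-- Difference

module Difference {S : Schema} (a b : Expr S) (σ ρ : Var → Var) (r : ℕ → Var)
  (correct-a : ∀ σ ρ r → Separated a σ ρ r → Correct a σ ρ r)
  (correct-b : ∀ σ ρ r → Separated b σ ρ r → Correct b σ ρ r)
  (sep : Separated (a −ₑ b) σ ρ r) where

  open Separated sep

  t : ℕ → Var
  t = odds (odds r)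

  sep-a : Separated a σ ρ (evens r)
  sep-a = record
    { ρ-injective = ρ-injective
    ; r-injective = evens-injective r-injective
    ; ρ≢r = λ x k o → ρ≢r x _ o
    ; σ≢ρ = λ y x i o → σ≢ρ y x (inj₁ i) o
    ; σ≢r = λ y k i → σ≢r y _ (inj₁ i)
    }

  sep-b : Separated b σ t (evens (odds r))
  sep-b = record
    { ρ-injective = λ x y _ _ e → odds-injective (odds-injective r-injective) e
    ; r-injective = evens-injective (odds-injective r-injective)
    ; ρ≢r = λ x k o e → evens≢odds (odds-injective r-injective) k x (sym e)
    ; σ≢ρ = λ y x i o → σ≢r y _ (inj₂ (inj₁ i))
    ; σ≢r = λ y k i → σ≢r y _ (inj₂ (inj₁ i))
    }

  module A = Correct (correct-a σ ρ (evens r) sep-a)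
  module B = Correct (correct-b σ t (evens (odds r)) sep-b)

  β₁ β₂ : Expr S
  β₁ = expr a σ ρ (evens r)
  β₂ = expr b σ t (evens (odds r))
  t₁ t₂ Z : List Var
  t₁ = temps a σ ρ (evens r)
  t₂ = temps b σ t (evens (odds r))
  Z = L.map t (outputs b) ++ t₂
  C : List (Var × Var)
  C = diffEquations a b σ ρ t
  resetsZ equalitiesC : List (Expr S)
  resetsZ = resets Z
  equalitiesC = equalities C
  A B₀ B₁ B : Expr S
  A = seqAll β₁ resetsZ
  B₀ = β₁ ⨾ β₂
  B₁ = seqAll B₀ equalitiesC
  B = seqAll B₁ resetsZ

  data Equation : Var × Var → Set where
    both : ∀ x → Out a x → Out b x → Equation (t x , ρ x)
    onlyB : ∀ x → Out b x → ¬ Out a x → Equation (t x , σ x)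
    onlyA : ∀ x → Out a x → ¬ Out b x → Equation (ρ x , σ x)

  ∈-C⁻ : ∀ pq → pq ∈ₗ C → Equation pq
  ∈-C⁻ pq pq∈ with ∈-++⁻ (L.map (λ x → t x , ρ x) (filter (Out? a) (outputs b))) pq∈
  ... | inj₁ pq∈₁ with ∈-map⁻ (λ x → t x , ρ x) pq∈₁
  ...   | x , x∈ , refl with ∈-filter⁻ (Out? a) x∈
  ...     | x∈b , oa = both x oa (∈-outputs⁻ b x∈b)
  ∈-C⁻ pq pq∈ | inj₂ pq∈′ with ∈-++⁻ (L.map (λ x → t x , σ x) (outputsOnly b a)) pq∈′
  ... | inj₁ pq∈₂ with ∈-map⁻ (λ x → t x , σ x) pq∈₂
  ...   | x , x∈ , refl with ∈-filter⁻ (λ x → ¬? (Out? a x)) x∈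
  ...     | x∈b , ¬oa = onlyB x (∈-outputs⁻ b x∈b) ¬oa
  ∈-C⁻ pq pq∈ | inj₂ pq∈′ | inj₂ pq∈₃ with ∈-map⁻ (λ x → ρ x , σ x) pq∈₃
  ...   | x , x∈ , refl with ∈-filter⁻ (λ x → ¬? (Out? b x)) x∈
  ...     | x∈a , ¬ob = onlyA x (∈-outputs⁻ a x∈a) ¬ob

  ∈-C-both : ∀ x → Out a x → Out b x → (t x , ρ x) ∈ₗ C
  ∈-C-both x oa ob = ∈-++⁺ˡ (∈-map⁺ (λ x → t x , ρ x) (∈-filter⁺ (Out? a) (∈-outputs⁺ b ob) oa))
  ∈-C-onlyB : ∀ x → Out b x → ¬ Out a x → (t x , σ x) ∈ₗ C
  ∈-C-onlyB x ob ¬oa = ∈-++⁺ʳ (L.map (λ x → t x , ρ x) (filter (Out? a) (outputs b)))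
    (∈-++⁺ˡ (∈-map⁺ (λ x → t x , σ x) (∈-filter⁺ (λ x → ¬? (Out? a x)) (∈-outputs⁺ b ob) ¬oa)))
  ∈-C-onlyA : ∀ x → Out a x → ¬ Out b x → (ρ x , σ x) ∈ₗ C
  ∈-C-onlyA x oa ¬ob = ∈-++⁺ʳ (L.map (λ x → t x , ρ x) (filter (Out? a) (outputs b)))
    (∈-++⁺ʳ (L.map (λ x → t x , σ x) (outputsOnly b a))
      (∈-map⁺ (λ x → ρ x , σ x) (∈-filter⁺ (λ x → ¬? (Out? b x)) (∈-outputs⁺ a oa) ¬ob)))

  Z-fresh : ∀ z → z ∈ₗ Z → ∃ λ k → z ≡ r k
  Z-fresh z z∈ with ∈-++⁻ (L.map t (outputs b)) z∈
  ... | inj₁ z∈₁ with ∈-map⁻ t z∈₁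
  ...   | x , _ , e = suc (2 * suc (2 * x)) , e
  Z-fresh z z∈ | inj₂ z∈₂ with B.temps-fresh z z∈₂
  ...   | k , e = suc (2 * (2 * k)) , e

  t∈Z : ∀ x → Out b x → t x ∈ₗ Z
  t∈Z x ob = ∈-++⁺ˡ (∈-map⁺ t (∈-outputs⁺ b ob))

  Out-β₂⊆Z : ∀ z → Out β₂ z → z ∈ₗ Z
  Out-β₂⊆Z z o with B.Out⊆ z o
  ... | inj₁ (x , ob , refl) = t∈Z x ob
  ... | inj₂ z∈ = ∈-++⁺ʳ (L.map t (outputs b)) z∈

  σ∉Out-β₁ : ∀ y → In (a −ₑ b) y → ¬ Out β₁ (σ y)
  σ∉Out-β₁ y i o with A.Out⊆ _ o
  ... | inj₁ (x , ox , e) = σ≢ρ y x i ox e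
  ... | inj₂ z∈ with A.temps-fresh _ z∈
  ...   | k , e = σ≢r y _ i e

  σ∉Z : ∀ y → In (a −ₑ b) y → ¬ σ y ∈ₗ Z
  σ∉Z y i σy∈ with Z-fresh _ σy∈
  ... | k , e = σ≢r y k i e

  σ∉Out-β₂ : ∀ y → In (a −ₑ b) y → ¬ Out β₂ (σ y)
  σ∉Out-β₂ y i o = σ∉Z y i (Out-β₂⊆Z _ o)

  ρ∉Z : ∀ x → Out a x → ¬ ρ x ∈ₗ Z
  ρ∉Z x o ρx∈ with Z-fresh _ ρx∈
  ... | k , e = ρ≢r x k o e

  ρ∉Out-β₂ : ∀ x → Out a x → ¬ Out β₂ (ρ x)
  ρ∉Out-β₂ x o o₂ = ρ∉Z x o (Out-β₂⊆Z _ o₂)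

  Out-A⊆ : ∀ z → Out A z → Out β₁ z ⊎ z ∈ₗ Z
  Out-A⊆ z o = Sum.map₂ (Out-resets⁻ Z) (Out-seqAll⁻ β₁ resetsZ o)

  Out-B⊆ : ∀ z → Out B z → Out β₁ z ⊎ z ∈ₗ Z
  Out-B⊆ z o with Out-seqAll⁻ B₁ resetsZ o
  ... | inj₂ o′ = inj₂ (Out-resets⁻ Z o′)
  ... | inj₁ o′ with Out-seqAll⁻ B₀ equalitiesC o′
  ...   | inj₂ o″ = ⊥-elim (¬Out-equalities C o″)
  ...   | inj₁ (inj₁ o″) = inj₁ o″
  ...   | inj₁ (inj₂ o″) = inj₂ (Out-β₂⊆Z z o″)

  Out-A⊆B : ∀ z → Out A z → Out B z
  Out-A⊆B z o with Out-A⊆ z o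
  ... | inj₁ o′ = Out-seqAll⁺ B₁ resetsZ (inj₁ (Out-seqAll⁺ B₀ equalitiesC (inj₁ (inj₁ o′))))
  ... | inj₂ z∈ = Out-seqAll⁺ B₁ resetsZ (inj₂ (Out-resets⁺ Z z∈))

  Out-B⊆A : ∀ z → Out B z → Out A z
  Out-B⊆A z o = Out-seqAll⁺ β₁ resetsZ (Sum.map₂ (Out-resets⁺ Z) (Out-B⊆ z o))

  ioResets : ∀ z → InAny resetsZ z → ¬ OutAny resetsZ z
  ioResets z i _ = ¬In-resets Z i

  ioEqualities : ∀ z → InAny equalitiesC z → ¬ OutAny equalitiesC z
  ioEqualities z _ o = ¬Out-equalities C o

  In-A⊆ : ∀ z → In A z → ∃ λ y → In (a −ₑ b) y × z ≡ σ y
  In-A⊆ z i with In-seqAll⁻ β₁ resetsZ i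
  ... | inj₂ (i′ , _) = ⊥-elim (¬In-resets Z i′)
  ... | inj₁ i′ with A.In⊆ z i′
  ...   | y , y∈ , e = y , inj₁ y∈ , e

  In-B₀⊆ : ∀ z → In B₀ z → ∃ λ y → In (a −ₑ b) y × z ≡ σ y
  In-B₀⊆ z (inj₁ i) with A.In⊆ z i
  ... | y , y∈ , e = y , inj₁ y∈ , e
  In-B₀⊆ z (inj₂ (i , _)) with B.In⊆ z i
  ... | y , y∈ , e = y , inj₂ (inj₁ y∈) , e

  In-equation⊆ : ∀ z → ¬ Out B₀ z → z ∈ₗ L.map proj₁ C ⊎ z ∈ₗ L.map proj₂ C → ∃ λ y → In (a −ₑ b) y × z ≡ σ y
  In-equation⊆ z ¬o (inj₁ z∈) with ∈-map⁻ proj₁ z∈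
  ... | pq , pq∈ , refl with ∈-C⁻ pq pq∈
  ...   | both x oa ob = ⊥-elim (¬o (inj₂ (B.Out-ρ x ob)))
  ...   | onlyB x ob ¬oa = ⊥-elim (¬o (inj₂ (B.Out-ρ x ob)))
  ...   | onlyA x oa ¬ob = ⊥-elim (¬o (inj₁ (A.Out-ρ x oa)))
  In-equation⊆ z ¬o (inj₂ z∈) with ∈-map⁻ proj₂ z∈
  ... | pq , pq∈ , refl with ∈-C⁻ pq pq∈
  ...   | both x oa ob = ⊥-elim (¬o (inj₁ (A.Out-ρ x oa)))
  ...   | onlyB x ob ¬oa = x , inj₂ (inj₂ (inj₂ (ob , ¬oa))) , refl
  ...   | onlyA x oa ¬ob = x , inj₂ (inj₂ (inj₁ (oa , ¬ob))) , refl

  In-B₁⊆ : ∀ z → In B₁ z → ∃ λ y → In (a −ₑ b) y × z ≡ σ y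
  In-B₁⊆ z i with In-seqAll⁻ B₀ equalitiesC i
  ... | inj₁ i′ = In-B₀⊆ z i′
  ... | inj₂ (i′ , ¬o) = In-equation⊆ z ¬o (In-equalities⁻ C i′)

  In-B⊆ : ∀ z → In B z → ∃ λ y → In (a −ₑ b) y × z ≡ σ y
  In-B⊆ z i with In-seqAll⁻ B₁ resetsZ i
  ... | inj₂ (i′ , _) = ⊥-elim (¬In-resets Z i′)
  ... | inj₁ i′ = In-B₁⊆ z i′

  ioDisjoint-A : IoDisjoint A
  ioDisjoint-A = IoDisjoint-seqAll β₁ resetsZ A.ioDisjoint (IoDisjoint-resets Z) ioResets β₁↛resets
    where
    β₁↛resets : ∀ z → In β₁ z → ¬ OutAny resetsZ z
    β₁↛resets z i o with A.In⊆ z i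
    ... | y , y∈ , refl = σ∉Z y (inj₁ y∈) (Out-resets⁻ Z o)

  ioDisjoint-B₀ : IoDisjoint B₀
  ioDisjoint-B₀ = ioB₀ , A.ioDisjoint , B.ioDisjoint
    where
    ioB₀ : ioDisjointHere B₀
    ioB₀ z (inj₁ i , inj₁ o) = IoDisjoint⇒ioDisjointHere β₁ A.ioDisjoint z (i , o)
    ioB₀ z (inj₁ i , inj₂ o) with A.In⊆ z i
    ... | y , y∈ , refl = σ∉Out-β₂ y (inj₁ y∈) o
    ioB₀ z (inj₂ (i , ¬o) , inj₁ o) = ¬o o
    ioB₀ z (inj₂ (i , ¬o) , inj₂ o) = IoDisjoint⇒ioDisjointHere β₂ B.ioDisjoint z (i , o)

  ioDisjoint-B : IoDisjoint B
  ioDisjoint-B =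
    IoDisjoint-seqAll B₁ resetsZ
      (IoDisjoint-seqAll B₀ equalitiesC ioDisjoint-B₀ (IoDisjoint-equalities C) ioEqualities
        (λ z _ o → ¬Out-equalities C o))
      (IoDisjoint-resets Z) ioResets B₁↛resets
    where
    B₁↛resets : ∀ z → In B₁ z → ¬ OutAny resetsZ z
    B₁↛resets z i o with In-B₁⊆ z i
    ... | y , y∈ , refl = σ∉Z y y∈ (Out-resets⁻ Z o)

  ioDisjointHere-AB : ioDisjointHere (A −ₑ B)
  ioDisjointHere-AB z (inj₁ i , o) = IoDisjoint⇒ioDisjointHere A ioDisjoint-A z (i , o)
  ioDisjointHere-AB z (inj₂ (inj₁ i) , o) = IoDisjoint⇒ioDisjointHere B ioDisjoint-B z (i , Out-A⊆B z o)
  ioDisjointHere-AB z (inj₂ (inj₂ (inj₁ (o₁ , ¬o₂))) , o) = ¬o₂ (Out-A⊆B z o₁)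
  ioDisjointHere-AB z (inj₂ (inj₂ (inj₂ (o₂ , ¬o₁))) , o) = ¬o₁ o

  In⊆ : ∀ z → In (A −ₑ B) z → ∃ λ y → In (a −ₑ b) y × z ≡ σ y
  In⊆ z (inj₁ i) = In-A⊆ z i
  In⊆ z (inj₂ (inj₁ i)) = In-B⊆ z i
  In⊆ z (inj₂ (inj₂ (inj₁ (o₁ , ¬o₂)))) = ⊥-elim (¬o₂ (Out-A⊆B z o₁))
  In⊆ z (inj₂ (inj₂ (inj₂ (o₂ , ¬o₁)))) = ⊥-elim (¬o₁ (Out-B⊆A z o₂))

  In-B-via-equations : ∀ y → In (a −ₑ b) y → σ y ∈ₗ L.map proj₂ C → In (A −ₑ B) (σ y)
  In-B-via-equations y i σy∈ = inj₂ (inj₁ (In-seqAll⁺ B₁ resetsZ ioResets (inj₁ (In-seqAll⁺ B₀ equalitiesC ioEqualities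
    (inj₂ (In-equalities⁺ C σy∈ , [ σ∉Out-β₁ y i , σ∉Out-β₂ y i ]))))))

  In⊇ : ∀ y → In (a −ₑ b) y → In (A −ₑ B) (σ y)
  In⊇ y (inj₁ ia) = inj₁ (In-seqAll⁺ β₁ resetsZ ioResets (inj₁ (A.In⊇ y ia)))
  In⊇ y (inj₂ (inj₁ ib)) = inj₂ (inj₁ (In-seqAll⁺ B₁ resetsZ ioResets (inj₁ (In-seqAll⁺ B₀ equalitiesC ioEqualities
    (inj₁ (inj₂ (B.In⊇ y ib , σ∉Out-β₁ y (inj₂ (inj₁ ib)))))))))
  In⊇ y i@(inj₂ (inj₂ (inj₁ (oa , ¬ob)))) = In-B-via-equations y i (∈-map⁺ proj₂ (∈-C-onlyA y oa ¬ob))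
  In⊇ y i@(inj₂ (inj₂ (inj₂ (ob , ¬oa)))) = In-B-via-equations y i (∈-map⁺ proj₂ (∈-C-onlyB y ob ¬oa))

  Out⊆ : ∀ z → Out (A −ₑ B) z → (∃ λ x → Out (a −ₑ b) x × z ≡ ρ x) ⊎ z ∈ₗ t₁ ++ Z
  Out⊆ z o with Out-A⊆ z o
  ... | inj₂ z∈ = inj₂ (∈-++⁺ʳ t₁ z∈)
  ... | inj₁ o′ = Sum.map₂ ∈-++⁺ˡ (A.Out⊆ z o′)

  Out-temps : ∀ z → z ∈ₗ t₁ ++ Z → Out (A −ₑ B) z
  Out-temps z z∈ = Out-seqAll⁺ β₁ resetsZ (Sum.map (A.Out-temps z) (Out-resets⁺ Z) (∈-++⁻ t₁ z∈))

  temps-fresh : ∀ z → z ∈ₗ t₁ ++ Z → ∃ λ k → z ≡ r k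
  temps-fresh z z∈ with ∈-++⁻ t₁ z∈
  ... | inj₂ z∈Z = Z-fresh z z∈Z
  ... | inj₁ z∈₁ with A.temps-fresh z z∈₁
  ...   | k , e = 2 * k , e

  module _ (𝕍 : Var → Set) (D : Instance S) (α⊆𝕍 : ∀ z → vars (a −ₑ b) z → 𝕍 z)
           (β⊆𝕍 : ∀ z → vars (A −ₑ B) z → 𝕍 z) where
    open Semantics {S = S} 𝕍 D
    open RunSemantics {S = S} 𝕍 D
    open BlockRuns {S = S} 𝕍 D

    a⊆𝕍 : ∀ z → vars a z → 𝕍 z
    a⊆𝕍 z v = α⊆𝕍 z (inj₁ v)
    b⊆𝕍 : ∀ z → vars b z → 𝕍 z
    b⊆𝕍 z v = α⊆𝕍 z (inj₂ v)
    A⊆𝕍 : ∀ z → vars A z → 𝕍 z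
    A⊆𝕍 z v = β⊆𝕍 z (inj₁ v)
    B⊆𝕍 : ∀ z → vars B z → 𝕍 z
    B⊆𝕍 z v = β⊆𝕍 z (inj₂ v)
    β₁⊆𝕍 : ∀ z → vars β₁ z → 𝕍 z
    β₁⊆𝕍 z v = A⊆𝕍 z (vars-seqAll⁺ β₁ resetsZ (inj₁ v))
    B₁⊆𝕍 : ∀ z → vars B₁ z → 𝕍 z
    B₁⊆𝕍 z v = B⊆𝕍 z (vars-seqAll⁺ B₁ resetsZ (inj₁ v))
    β₂⊆𝕍 : ∀ z → vars β₂ z → 𝕍 z
    β₂⊆𝕍 z v = B₁⊆𝕍 z (vars-seqAll⁺ B₀ equalitiesC (inj₁ (inj₂ v)))
    Z⊆𝕍 : ∀ z → z ∈ₗ Z → 𝕍 z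
    Z⊆𝕍 z z∈ = A⊆𝕍 z (vars-seqAll⁺ β₁ resetsZ (inj₂ (vars-resets Z z∈)))
    C⊆𝕍 : ∀ pq → pq ∈ₗ C → 𝕍 (proj₁ pq) × 𝕍 (proj₂ pq)
    C⊆𝕍 pq pq∈ = B₁⊆𝕍 _ (vars-seqAll⁺ B₀ equalitiesC (inj₂ (vars-equalities C (inj₁ (∈-map⁺ proj₁ pq∈))))) ,
                  B₁⊆𝕍 _ (vars-seqAll⁺ B₀ equalitiesC (inj₂ (vars-equalities C (inj₂ (∈-map⁺ proj₂ pq∈)))))
    ρ∈𝕍 : ∀ x → Out a x → 𝕍 (ρ x)
    ρ∈𝕍 x o = β₁⊆𝕍 _ (Out⊆vars β₁ (A.Out-ρ x o))
    σ∈𝕍 : ∀ y → In (a −ₑ b) y → 𝕍 (σ y)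
    σ∈𝕍 y i = β⊆𝕍 _ (In⊆vars (A −ₑ B) (In⊇ y i))

    unchanged-input : ∀ {ν₁ μ₁ μ : Val} → (∀ y → In (a −ₑ b) y → μ₁ (σ y) ≡ ν₁ y) → ⟦ β₁ ⟧ 𝕍 D μ₁ μ
      → ∀ y → In (a −ₑ b) y → μ (σ y) ≡ ν₁ y
    unchanged-input in≡ ⟦β₁⟧ y i = trans (sym (⟦⟧-frame β₁ ⟦β₁⟧ (σ y) (σ∈𝕍 y i) (σ∉Out-β₁ y i))) (in≡ y i)

    equations⇒⟦b⟧ : ∀ {ν₁ ν₂ μ₁ μ μ′ ν₂′ : Val} → (∀ y → In (a −ₑ b) y → μ₁ (σ y) ≡ ν₁ y)
      → ⟦ a ⟧ 𝕍 D ν₁ ν₂ → ⟦ β₁ ⟧ 𝕍 D μ₁ μ → (∀ x → Out a x → ν₂ x ≡ μ (ρ x))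
      → (∀ pq → pq ∈ₗ C → μ′ (proj₁ pq) ≡ μ′ (proj₂ pq)) → (∀ z → 𝕍 z → ¬ z ∈ₗ Z → μ′ z ≡ μ z)
      → ⟦ b ⟧ 𝕍 D ν₁ ν₂′ → (∀ x → Out b x → ν₂′ x ≡ μ′ (t x))
      → ⟦ b ⟧ 𝕍 D ν₁ ν₂
    equations⇒⟦b⟧ {ν₁} {ν₂} {μ₁} {μ} {μ′} {ν₂′} in≡ ⟦a⟧ ⟦β₁⟧ out≡a equal μ′≈μ ⟦b⟧′ out≡b =
      ⟦⟧-resp-≈ b b⊆𝕍 ⟦b⟧′ agree
      where
      open ≡-Reasoning
      agree : ∀ w → 𝕍 w → ν₂′ w ≡ ν₂ w
      agree w w∈𝕍 with Out? b w | Out? a w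
      ... | yes ob | yes oa = begin
        ν₂′ w     ≡⟨ out≡b w ob ⟩
        μ′ (t w)  ≡⟨ equal _ (∈-C-both w oa ob) ⟩
        μ′ (ρ w)  ≡⟨ μ′≈μ (ρ w) (ρ∈𝕍 w oa) (ρ∉Z w oa) ⟩
        μ (ρ w)   ≡⟨ sym (out≡a w oa) ⟩
        ν₂ w      ∎
      ... | yes ob | no ¬oa = begin
        ν₂′ w     ≡⟨ out≡b w ob ⟩
        μ′ (t w)  ≡⟨ equal _ (∈-C-onlyB w ob ¬oa) ⟩
        μ′ (σ w)  ≡⟨ μ′≈μ (σ w) (σ∈𝕍 w iw) (σ∉Z w iw) ⟩
        μ (σ w)   ≡⟨ unchanged-input in≡ ⟦β₁⟧ w iw ⟩
        ν₁ w      ≡⟨ ⟦⟧-frame a ⟦a⟧ w w∈𝕍 ¬oa ⟩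
        ν₂ w      ∎
        where iw = inj₂ (inj₂ (inj₂ (ob , ¬oa)))
      ... | no ¬ob | yes oa = begin
        ν₂′ w     ≡⟨ sym (⟦⟧-frame b ⟦b⟧′ w w∈𝕍 ¬ob) ⟩
        ν₁ w      ≡⟨ sym (unchanged-input in≡ ⟦β₁⟧ w iw) ⟩
        μ (σ w)   ≡⟨ sym (μ′≈μ (σ w) (σ∈𝕍 w iw) (σ∉Z w iw)) ⟩
        μ′ (σ w)  ≡⟨ sym (equal _ (∈-C-onlyA w oa ¬ob)) ⟩
        μ′ (ρ w)  ≡⟨ μ′≈μ (ρ w) (ρ∈𝕍 w oa) (ρ∉Z w oa) ⟩
        μ (ρ w)   ≡⟨ sym (out≡a w oa) ⟩
        ν₂ w      ∎
        where iw = inj₂ (inj₂ (inj₁ (oa , ¬ob)))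
      ... | no ¬ob | no ¬oa = trans (sym (⟦⟧-frame b ⟦b⟧′ w w∈𝕍 ¬ob)) (⟦⟧-frame a ⟦a⟧ w w∈𝕍 ¬oa)

    ⟦b⟧⇒equations : ∀ {ν₁ ν₂ μ₁ μ μ′ : Val} → (∀ y → In (a −ₑ b) y → μ₁ (σ y) ≡ ν₁ y)
      → ⟦ a ⟧ 𝕍 D ν₁ ν₂ → ⟦ β₁ ⟧ 𝕍 D μ₁ μ → (∀ x → Out a x → ν₂ x ≡ μ (ρ x))
      → ⟦ b ⟧ 𝕍 D ν₁ ν₂ → ⟦ β₂ ⟧ 𝕍 D μ μ′ → (∀ x → Out b x → ν₂ x ≡ μ′ (t x))
      → ∀ pq → pq ∈ₗ C → μ′ (proj₁ pq) ≡ μ′ (proj₂ pq)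
    ⟦b⟧⇒equations {ν₁} {ν₂} {μ₁} {μ} {μ′} in≡ ⟦a⟧ ⟦β₁⟧ out≡a ⟦b⟧ ⟦β₂⟧ out≡b pq pq∈ = holds (∈-C⁻ pq pq∈)
      where
      open ≡-Reasoning
      frame₂ : ∀ z → 𝕍 z → ¬ Out β₂ z → μ z ≡ μ′ z
      frame₂ = ⟦⟧-frame β₂ ⟦β₂⟧
      holds : ∀ {pq} → Equation pq → μ′ (proj₁ pq) ≡ μ′ (proj₂ pq)
      holds (both x oa ob) = begin
        μ′ (t x)  ≡⟨ sym (out≡b x ob) ⟩
        ν₂ x      ≡⟨ out≡a x oa ⟩
        μ (ρ x)   ≡⟨ frame₂ (ρ x) (ρ∈𝕍 x oa) (ρ∉Out-β₂ x oa) ⟩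
        μ′ (ρ x)  ∎
      holds (onlyB x ob ¬oa) = begin
        μ′ (t x)  ≡⟨ sym (out≡b x ob) ⟩
        ν₂ x      ≡⟨ sym (⟦⟧-frame a ⟦a⟧ x (b⊆𝕍 x (Out⊆vars b ob)) ¬oa) ⟩
        ν₁ x      ≡⟨ sym (unchanged-input in≡ ⟦β₁⟧ x ix) ⟩
        μ (σ x)   ≡⟨ frame₂ (σ x) (σ∈𝕍 x ix) (σ∉Out-β₂ x ix) ⟩
        μ′ (σ x)  ∎
        where ix = inj₂ (inj₂ (inj₂ (ob , ¬oa)))
      holds (onlyA x oa ¬ob) = begin
        μ′ (ρ x)  ≡⟨ sym (frame₂ (ρ x) (ρ∈𝕍 x oa) (ρ∉Out-β₂ x oa)) ⟩
        μ (ρ x)   ≡⟨ sym (out≡a x oa) ⟩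
        ν₂ x      ≡⟨ sym (⟦⟧-frame b ⟦b⟧ x (a⊆𝕍 x (Out⊆vars a oa)) ¬ob) ⟩
        ν₁ x      ≡⟨ sym (unchanged-input in≡ ⟦β₁⟧ x ix) ⟩
        μ (σ x)   ≡⟨ frame₂ (σ x) (σ∈𝕍 x ix) (σ∉Out-β₂ x ix) ⟩
        μ′ (σ x)  ∎
        where ix = inj₂ (inj₂ (inj₁ (oa , ¬ob)))

    simulates : ∀ ν₁ ν₂ μ₁ → (∀ y → In (a −ₑ b) y → μ₁ (σ y) ≡ ν₁ y) → ⟦ a −ₑ b ⟧ 𝕍 D ν₁ ν₂
      → ∃ λ μ₂ → ⟦ A −ₑ B ⟧ 𝕍 D μ₁ μ₂ × (∀ x → Out a x → ν₂ x ≡ μ₂ (ρ x))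
    simulates ν₁ ν₂ μ₁ in≡ (⟦a⟧ , ¬⟦b⟧) with A.simulates 𝕍 D a⊆𝕍 β₁⊆𝕍 ν₁ ν₂ μ₁ (λ y i → in≡ y (inj₁ i)) ⟦a⟧
    ... | μ , ⟦β₁⟧ , out≡a with run-resets⁺ Z μ Z⊆𝕍
    ...   | μ₂ , runZ , (_ , untouched) =
      μ₂ , (⟦seqAll⟧⁺ β₁ resetsZ A⊆𝕍 ⟦β₁⟧ runZ , ¬⟦B⟧) ,
      λ x o → trans (out≡a x o) (untouched (ρ x) (ρ∈𝕍 x o) (ρ∉Z x o))
      where
      ¬⟦B⟧ : ¬ ⟦ B ⟧ 𝕍 D μ₁ μ₂
      ¬⟦B⟧ ⟦B⟧ with ⟦seqAll⟧⁻ B₁ resetsZ ⟦B⟧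
      ... | μ″ , ⟦B₁⟧ , runZ′ with ⟦seqAll⟧⁻ B₀ equalitiesC ⟦B₁⟧ | run-resets⁻ Z Z⊆𝕍 runZ′
      ...   | μ′ , (μ₀ , ⟦β₁⟧′ , ⟦β₂⟧) , runC | _ , untouched′ with run-equalities⁻ C C⊆𝕍 runC
      ...     | equal , μ′≈μ″
        with B.reflects 𝕍 D b⊆𝕍 β₂⊆𝕍 ν₁ μ₀ μ′ (λ y i → unchanged-input in≡ ⟦β₁⟧′ y (inj₂ (inj₁ i))) ⟦β₂⟧
      ...       | ν₂′ , ⟦b⟧′ , out≡b = ¬⟦b⟧ (equations⇒⟦b⟧ in≡ ⟦a⟧ ⟦β₁⟧ out≡a equal μ′≈μ ⟦b⟧′ out≡b)
        where
        μ′≈μ : ∀ z → 𝕍 z → ¬ z ∈ₗ Z → μ′ z ≡ μ z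
        μ′≈μ z z∈𝕍 z∉ = trans (μ′≈μ″ z z∈𝕍) (trans (untouched′ z z∈𝕍 z∉) (sym (untouched z z∈𝕍 z∉)))

    reflects : ∀ ν₁ μ₁ μ₂ → (∀ y → In (a −ₑ b) y → μ₁ (σ y) ≡ ν₁ y) → ⟦ A −ₑ B ⟧ 𝕍 D μ₁ μ₂
      → ∃ λ ν₂ → ⟦ a −ₑ b ⟧ 𝕍 D ν₁ ν₂ × (∀ x → Out a x → ν₂ x ≡ μ₂ (ρ x))
    reflects ν₁ μ₁ μ₂ in≡ (⟦A⟧ , ¬⟦B⟧) with ⟦seqAll⟧⁻ β₁ resetsZ ⟦A⟧
    ... | μ , ⟦β₁⟧ , runZ with run-resets⁻ Z Z⊆𝕍 runZ
    ...   | zeroed , untouched with A.reflects 𝕍 D a⊆𝕍 β₁⊆𝕍 ν₁ μ₁ μ (λ y i → in≡ y (inj₁ i)) ⟦β₁⟧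
    ...     | ν₂ , ⟦a⟧ , out≡a = ν₂ , (⟦a⟧ , ¬⟦b⟧) , λ x o → trans (out≡a x o) (untouched (ρ x) (ρ∈𝕍 x o) (ρ∉Z x o))
      where
      ¬⟦b⟧ : ¬ ⟦ b ⟧ 𝕍 D ν₁ ν₂
      ¬⟦b⟧ ⟦b⟧ with B.simulates 𝕍 D b⊆𝕍 β₂⊆𝕍 ν₁ ν₂ μ (λ y i → unchanged-input in≡ ⟦β₁⟧ y (inj₂ (inj₁ i))) ⟦b⟧
      ... | μ′ , ⟦β₂⟧ , out≡b with run-resets⁺ Z μ′ Z⊆𝕍
      ...   | μ₂′ , runZ′ , (zeroed′ , untouched′) = ¬⟦B⟧ (⟦⟧-resp-≈ B B⊆𝕍 ⟦B⟧′ μ₂′≈μ₂)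
        where
        ⟦B⟧′ : ⟦ B ⟧ 𝕍 D μ₁ μ₂′
        ⟦B⟧′ = ⟦seqAll⟧⁺ B₁ resetsZ B⊆𝕍
                 (⟦seqAll⟧⁺ B₀ equalitiesC B₁⊆𝕍 (μ , ⟦β₁⟧ , ⟦β₂⟧)
                   (run-equalities⁺ C μ′ (⟦b⟧⇒equations in≡ ⟦a⟧ ⟦β₁⟧ out≡a ⟦b⟧ ⟦β₂⟧ out≡b)))
                 runZ′
        μ₂′≈μ₂ : μ₂′ ≈ μ₂
        μ₂′≈μ₂ z z∈𝕍 with z ∈? Z
        ... | yes z∈ = trans (zeroed′ z z∈) (sym (zeroed z z∈))
        ... | no z∉ = trans (sym (untouched′ z z∈𝕍 z∉))
                        (trans (sym (⟦⟧-frame β₂ ⟦β₂⟧ z z∈𝕍 (λ o → z∉ (Out-β₂⊆Z z o)))) (untouched z z∈𝕍 z∉))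

  correct : Correct (a −ₑ b) σ ρ r
  correct = record
    { ioDisjoint = ioDisjointHere-AB , ioDisjoint-A , ioDisjoint-B
    ; In⊆ = In⊆
    ; In⊇ = In⊇
    ; Out⊆ = Out⊆
    ; Out-ρ = λ x o → Out-seqAll⁺ β₁ resetsZ (inj₁ (A.Out-ρ x o))
    ; Out-temps = Out-temps
    ; temps-fresh = temps-fresh
    ; simulates = simulates
    ; reflects = reflects
    }

correct : ∀ {S : Schema} (α : Expr S) σ ρ r → Separated α σ ρ r → Correct α σ ρ r
correct (atom R xs ys) = correct-atom R xs ys
correct (eqv x y) σ ρ r _ = correct-eqv x y σ ρ r
correct (eqc x c) σ ρ r _ = correct-eqc x c σ ρ r
correct (asgv x y) = correct-asgv x y
correct (asgc x c) σ ρ r _ = correct-asgc x c σ ρ r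
correct (a ⨾ b) σ ρ r = Composition.correct a b σ ρ r (correct a) (correct b)
correct (a ∪ₑ b) σ ρ r = Union.correct a b σ ρ r (correct a) (correct b)
correct (a −ₑ b) σ ρ r = Difference.correct a b σ ρ r (correct a) (correct b)

freshSupply : (xs : List Var) → Σ (ℕ → Var) λ r → Injective _≡_ _≡_ r × (∀ z k → z ∈ₗ xs → z ≢ r k)
freshSupply xs = r , r-injective , z≢r
  where
  bound = max 0 xs
  r : ℕ → Var
  r k = suc (bound + k)
  r-injective : Injective _≡_ _≡_ r
  r-injective e = +-cancelˡ-≡ bound _ _ (suc-injective e)
  z≢r : ∀ z k → z ∈ₗ xs → z ≢ r k
  z≢r z k z∈ = <⇒≢ (s≤s (≤-trans (All.lookup (xs≤max 0 xs) z∈) (m≤m+n bound k)))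

theorem5p1 : {S : Schema} (α : Expr S) (ρ : Var → Var)
    → (∀ x y → Out α x → Out α y → ρ x ≡ ρ y → x ≡ y)
    → (∀ x → Out α x → ¬ vars α (ρ x))
    → Σ (Expr S) λ β →
        IoDisjoint β
        × (∀ z → In β z ⇔ In α z)
        × (∀ x → Out α x → Out β (ρ x))
        × ((𝕍 : Var → Set) → (∀ z → vars α z → 𝕍 z) → (∀ z → vars β z → 𝕍 z)
           → (D : Instance S) → (ν₁ : Val)
           → (∀ ν₂ → ⟦ α ⟧ 𝕍 D ν₁ ν₂
                → ∃ λ ν₂' → ⟦ β ⟧ 𝕍 D ν₁ ν₂' × (∀ x → Out α x → ν₂ x ≡ ν₂' (ρ x)))
           × (∀ ν₂' → ⟦ β ⟧ 𝕍 D ν₁ ν₂'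
                → ∃ λ ν₂ → ⟦ α ⟧ 𝕍 D ν₁ ν₂ × (∀ x → Out α x → ν₂ x ≡ ν₂' (ρ x))))
theorem5p1 α ρ ρ-injective ρ-fresh =
  expr α id ρ r , C.ioDisjoint , (λ z → mk⇔ (In-back z) (C.In⊇ z)) , C.Out-ρ ,
  λ 𝕍 α⊆𝕍 β⊆𝕍 D ν₁ → (λ ν₂ → C.simulates 𝕍 D α⊆𝕍 β⊆𝕍 ν₁ ν₂ ν₁ (λ _ _ → refl)) ,
                      (λ ν₂′ → C.reflects 𝕍 D α⊆𝕍 β⊆𝕍 ν₁ ν₁ ν₂′ (λ _ _ → refl))
  where
  supply = freshSupply (variables α ++ L.map ρ (outputs α))
  r = proj₁ supply
  sep : Separated α id ρ r
  sep = record
    { ρ-injective = ρ-injective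
    ; r-injective = proj₁ (proj₂ supply)
    ; ρ≢r = λ x k o → proj₂ (proj₂ supply) (ρ x) k (∈-++⁺ʳ (variables α) (∈-map⁺ ρ (∈-outputs⁺ α o)))
    ; σ≢ρ = λ y x i o y≡ρx → ρ-fresh x o (subst (vars α) y≡ρx (In⊆vars α i))
    ; σ≢r = λ y k i → proj₂ (proj₂ supply) y k (∈-++⁺ˡ (∈-variables⁺ α (In⊆vars α i)))
    }
  module C = Correct (correct α id ρ r sep)
  In-back : ∀ z → In (expr α id ρ r) z → In α z
  In-back z i with C.In⊆ z i
  ... | y , y∈ , refl = y∈
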